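{- For integers $n\ge 2$ and $k$, let $Q_n(k) := P\big(2n-1-|S-S| = k \,\big|\, 0\in S,\ n-1\in S\big)$, where $S$ is a uniformly random subset of $[n]$; and for positive integers $m$ let \[ g_k(m) := P_{S\subseteq[2m]}\big(|(S-S)\cap\{m,\dots,2m-1\}| = m-k \,\big|\, 0\in S,\ 2m-1\in S\big), \] with $S$ a uniformly random subset of $[2m]$. Then for all integers $k\ge 0$, all integers $m>k$ and all $\varepsilon>0$, for all sufficiently large $n$, \[ |Q_n(2k) - g_k(m)| < \varepsilon + \tfrac{16}{9}\left(\tfrac{3}{4}\right)^{m+1}. \]
   Context: For a positive integer $n$, $[n] := \{0,1,\dots,n-1\}$; random subsets are uniform over all $2^n$ subsets. $S-S := \{x-y : x,y\in S\}$. -}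

module Defs where

open import Data.Bool using (Bool; true; false; _∧_; if_then_else_)
open import Data.Nat as ℕ using (ℕ; zero; suc)
open import Data.Integer as ℤ using (ℤ; +_)
open import Data.Rational as ℚ using (ℚ)
open import Data.Fin using (Fin; toℕ)
open import Data.Fin.Subset using (Subset)
open import Data.Vec using (Vec; []; _∷_; lookup)
open import Data.List using (List; []; _∷_; map; _++_; length; filterᵇ; upTo; allFin)
open import Data.Bool.ListAction using (any)
open import Relation.Nullary using (does)
open import Relation.Binary.PropositionalEquality using (_≡_)

allSubsets : (n : ℕ) → List (Subset n)
allSubsets zero    = [] ∷ []
allSubsets (suc n) = map (false ∷_) (allSubsets n) ++ map (true ∷_) (allSubsets n)

count : (n : ℕ) → (Subset n → Bool) → ℕ
count n P = length (filterᵇ P (allSubsets n))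

-- Conditional probability P(A | B) for a uniformly random subset of [n]
-- (set to 0 if B has probability 0, which never happens below).
condProb : (n : ℕ) → (A B : Subset n → Bool) → ℚ
condProb n A B with count n B
... | zero  = ℚ.0ℚ
... | suc c = (+ count n (λ S → A S ∧ B S)) ℚ./ suc c

_∈ᵇ_ : {n : ℕ} → ℕ → Subset n → Bool
_∈ᵇ_ {n} i S = any (λ x → does (toℕ x ℕ.≟ i) ∧ lookup S x) (allFin n)

inDiff : {n : ℕ} → Subset n → ℤ → Bool
inDiff {n} S d =
  any (λ x → any (λ y → lookup S x ∧ lookup S y ∧
                        does ((+ toℕ x) ℤ.- (+ toℕ y) ℤ.≟ d)) (allFin n)) (allFin n)

-- |S - S| for S ⊆ [n]: S - S ⊆ {-(n-1), …, n-1}, so we count the integers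
-- d = i - (n-1) for i = 0, …, 2n-2 that lie in S - S.
diffCard : {n : ℕ} → Subset n → ℕ
diffCard {n} S =
  length (filterᵇ (λ i → inDiff S ((+ i) ℤ.- (+ (n ℕ.∸ 1))))
                 (upTo (2 ℕ.* n ℕ.∸ 1)))

diffCardUpper : {n : ℕ} → (m : ℕ) → Subset n → ℕ
diffCardUpper m S =
  length (filterᵇ (λ i → inDiff S (+ (m ℕ.+ i))) (upTo m))

Q : (n : ℕ) → ℤ → ℚ
Q n k = condProb n
  (λ S → does (((+ (2 ℕ.* n)) ℤ.- (+ 1) ℤ.- (+ diffCard S)) ℤ.≟ k))
  (λ S → (0 ∈ᵇ S) ∧ ((n ℕ.∸ 1) ∈ᵇ S))

g : ℤ → ℕ → ℚ
g k m = condProb (2 ℕ.* m)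
  (λ S → does ((+ diffCardUpper m S) ℤ.≟ ((+ m) ℤ.- k)))
  (λ S → (0 ∈ᵇ S) ∧ ((2 ℕ.* m ℕ.∸ 1) ∈ᵇ S))

_^ᵠ_ : ℚ → ℕ → ℚ
q ^ᵠ zero  = ℚ.1ℚ
q ^ᵠ suc n = q ℚ.* (q ^ᵠ n)

-- Write n = m + r + m and S = A ++ M ++ B with A, B ⊆ [m]. When 0 ∈ S the set S - S is symmetric, so
-- 2n - 1 - |S - S| is twice the number of d ∈ {1, …, n - 1} missing from S - S. A difference d ≥ m + r of S
-- joins a point of A to a point of B, so the missing d ≥ m + r are, after shifting by r, exactly the missing
-- differences of A ++ B ⊆ [2m] in {m, …, 2m - 1}. Hence the events defining Q_n(2k) and g_k(m) agree unless
-- some d < m + r is missing, and by a union bound it remains to sum P(d ∉ S - S | 0, n - 1 ∈ S) over these d.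
-- A difference d is missing iff no x has x, x + d ∈ S. For d ≤ n / 2 cut [n] into blocks of length 2d: each
-- of the d pairs (x, x + d) inside a block avoids S × S in 3 of 4 cases, giving (3/4)^{n/4} up to a constant.
-- For larger d write S = X ++ M ++ Y with |X| = |Y| = n - d: then X and Y are disjoint, 0 ∈ X and the last
-- point of Y lies in S, giving (3/4)^{n-d-2}/4; these sum to (3/4)^{m-1} = (16/9) (3/4)^{m+1}.

module Submission where

open import Defs
open import Data.Bool using (Bool; true; false; _∧_; not; T?)
open import Data.Bool.ListAction using (any)
open import Data.Bool.Properties using (T-≡; ∧-conicalˡ; ∧-conicalʳ; ∧-identityʳ; not-injective)
open import Data.Empty using (⊥; ⊥-elim)
open import Data.Fin using (Fin; toℕ; fromℕ<)
open import Data.Fin.Properties using (toℕ-fromℕ<)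
open import Data.Fin.Subset using (Subset)
open import Data.Integer as ℤ using (ℤ; +_; -[1+_])
import Data.Integer.Properties as ℤP
open import Data.Integer.Tactic.RingSolver as ℤSolver using ()
open import Data.List as List using (length; filterᵇ; applyUpTo; allFin)
open import Data.List.Properties using (filter-++; length-++)
open import Data.List.Membership.Propositional using (lose)
open import Data.List.Membership.Propositional.Properties using (∈-allFin)
open import Data.List.Relation.Unary.Any using (satisfied)
open import Data.List.Relation.Unary.Any.Properties using (any⁺; any⁻)
open import Data.Nat as ℕ using (ℕ; zero; suc; _+_; _*_; _∸_; _^_; _≤_; _<_; z≤n; s≤s; _≤′_; ≤′-refl; ≤′-step)
open import Data.Nat.Properties
open import Data.Nat.DivMod using (_/_; _%_; m≡m%n+[m/n]*n; m%n<n; m≥n⇒m/n>0)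
open import Algebra.Properties.CommutativeSemigroup +-commutativeSemigroup using (interchange)
open import Algebra.Properties.CommutativeSemigroup *-commutativeSemigroup using () renaming (x∙yz≈y∙xz to x*[y*z]≡y*[x*z])
import Data.Nat.Tactic.RingSolver as ℕSolver
open import Data.Product using (∃; _×_; _,_; proj₁; proj₂)
import Data.Rational as ℚ
open import Data.Rational using (ℚ; mkℚ)
import Data.Rational.Properties as ℚP
open import Data.Rational.Unnormalised as ℚᵘ using (ℚᵘ; mkℚᵘ; *≤*; *<*; *≡*)
import Data.Rational.Unnormalised.Properties as ℚᵘP
open import Data.Sum using (inj₁; inj₂)
open import Data.Vec using ([]; _∷_; lookup; _++_; tail)
open import Function.Base using (_∘_)
open import Function.Bundles using (Equivalence; mk⇔)
open import Relation.Binary.PropositionalEquality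
open import Relation.Nullary using (Dec; yes; does)
open import Relation.Nullary.Decidable using (dec-true; does-⇔)

𝟙 : Bool → ℕ
𝟙 true  = 1
𝟙 false = 0

𝟙≤1 : ∀ b → 𝟙 b ≤ 1
𝟙≤1 true  = ≤-refl
𝟙≤1 false = z≤n

𝟙-∧ : ∀ a b → 𝟙 (a ∧ b) ≡ 𝟙 a * 𝟙 b
𝟙-∧ true  b = sym (+-identityʳ (𝟙 b))
𝟙-∧ false b = refl

𝟙-∧≤ˡ : ∀ a b → 𝟙 (a ∧ b) ≤ 𝟙 a
𝟙-∧≤ˡ true  b = 𝟙≤1 b
𝟙-∧≤ˡ false b = z≤n

𝟙-+-𝟙-not : ∀ b → 𝟙 b + 𝟙 (not b) ≡ 1
𝟙-+-𝟙-not true  = refl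
𝟙-+-𝟙-not false = refl

𝟙-mono : ∀ a b → (a ≡ true → b ≡ true) → 𝟙 a ≤ 𝟙 b
𝟙-mono false b     _   = z≤n
𝟙-mono true  b a⇒b rewrite a⇒b refl = ≤-refl

𝟙-∧-≤-+ : ∀ q g c e → (c ≡ true → e ≡ 0 → q ≡ g) → 𝟙 (q ∧ c) ≤ 𝟙 (g ∧ c) + e
𝟙-∧-≤-+ false g c     e       _   = z≤n
𝟙-∧-≤-+ true  g false e       _   = z≤n
𝟙-∧-≤-+ true  g true  (suc e) _   = ≤-trans (s≤s z≤n) (m≤n+m (suc e) _)
𝟙-∧-≤-+ true  g true  zero    q≡g with q≡g refl refl
... | refl = s≤s z≤n

𝟙-not-≤-* : ∀ a b c → (b ≡ false → a ≡ true) → (c ≡ true → a ≡ true) → 𝟙 (not a) ≤ 𝟙 b * 𝟙 (not c)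
𝟙-not-≤-* true  b     c     _  _  = z≤n
𝟙-not-≤-* false false c     b⇒ _  with b⇒ refl
... | ()
𝟙-not-≤-* false true  true  _  c⇒ with c⇒ refl
... | ()
𝟙-not-≤-* false true  false _  _  = ≤-refl

bool-ext : ∀ {a b : Bool} → (a ≡ true → b ≡ true) → (b ≡ true → a ≡ true) → a ≡ b
bool-ext {true}  a⇒b _   = sym (a⇒b refl)
bool-ext {false} {true}  _ b⇒a = b⇒a refl
bool-ext {false} {false} _ _   = refl

sumBelow : ℕ → (ℕ → ℕ) → ℕ
sumBelow zero    f = 0
sumBelow (suc K) f = f 0 + sumBelow K (λ i → f (suc i))

sumBelow-cong : ∀ K {f g : ℕ → ℕ} → (∀ i → i < K → f i ≡ g i) → sumBelow K f ≡ sumBelow K g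
sumBelow-cong zero    f≡g = refl
sumBelow-cong (suc K) f≡g = cong₂ _+_ (f≡g 0 (s≤s z≤n)) (sumBelow-cong K (λ i i<K → f≡g (suc i) (s≤s i<K)))

sumBelow-mono : ∀ K {f g : ℕ → ℕ} → (∀ i → i < K → f i ≤ g i) → sumBelow K f ≤ sumBelow K g
sumBelow-mono zero    f≤g = z≤n
sumBelow-mono (suc K) f≤g = +-mono-≤ (f≤g 0 (s≤s z≤n)) (sumBelow-mono K (λ i i<K → f≤g (suc i) (s≤s i<K)))

sumBelow-+ : ∀ K f g → sumBelow K (λ i → f i + g i) ≡ sumBelow K f + sumBelow K g
sumBelow-+ zero    f g = refl
sumBelow-+ (suc K) f g = trans (cong (λ s → f 0 + g 0 + s) (sumBelow-+ K _ _)) (interchange (f 0) (g 0) _ _)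

sumBelow-*ˡ : ∀ K c f → c * sumBelow K f ≡ sumBelow K (λ i → c * f i)
sumBelow-*ˡ zero    c f = *-zeroʳ c
sumBelow-*ˡ (suc K) c f = trans (*-distribˡ-+ c (f 0) _) (cong (λ s → c * f 0 + s) (sumBelow-*ˡ K c _))

sumBelow-const : ∀ K c → sumBelow K (λ _ → c) ≡ K * c
sumBelow-const zero    c = refl
sumBelow-const (suc K) c = cong (λ s → c + s) (sumBelow-const K c)

sumBelow-split : ∀ a b f → sumBelow (a + b) f ≡ sumBelow a f + sumBelow b (λ i → f (a + i))
sumBelow-split zero    b f = refl
sumBelow-split (suc a) b f = trans (cong (λ s → f 0 + s) (sumBelow-split a b _)) (sym (+-assoc (f 0) _ _))

sumBelow-last : ∀ K f → sumBelow (suc K) f ≡ sumBelow K f + f K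
sumBelow-last zero    f = +-identityʳ (f 0)
sumBelow-last (suc K) f = trans (cong (λ s → f 0 + s) (sumBelow-last K _)) (sym (+-assoc (f 0) _ _))

sumBelow-reverse : ∀ K f → sumBelow K f ≡ sumBelow K (λ i → f (K ∸ suc i))
sumBelow-reverse zero    f = refl
sumBelow-reverse (suc K) f = begin
  f 0 + sumBelow K (λ i → f (suc i))
    ≡⟨ cong (λ s → f 0 + s) (sumBelow-reverse K _) ⟩
  f 0 + sumBelow K (λ i → f (suc (K ∸ suc i)))
    ≡⟨ +-comm (f 0) _ ⟩
  sumBelow K (λ i → f (suc (K ∸ suc i))) + f 0
    ≡⟨ cong₂ _+_ (sumBelow-cong K (λ i i<K → cong f (sym (+-∸-assoc 1 i<K)))) (cong f (sym (n∸n≡0 K))) ⟩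
  sumBelow K (λ i → f (suc K ∸ suc i)) + f (suc K ∸ suc K)
    ≡⟨ sym (sumBelow-last K _) ⟩
  sumBelow (suc K) (λ i → f (suc K ∸ suc i)) ∎
  where open ≡-Reasoning

length-filterᵇ-applyUpTo : ∀ K (P : ℕ → Bool) f → length (filterᵇ P (applyUpTo f K)) ≡ sumBelow K (λ i → 𝟙 (P (f i)))
length-filterᵇ-applyUpTo zero    P f = refl
length-filterᵇ-applyUpTo (suc K) P f with P (f 0)
... | true  = cong suc (length-filterᵇ-applyUpTo K P _)
... | false = length-filterᵇ-applyUpTo K P _

sumSubsets : (n : ℕ) → (Subset n → ℕ) → ℕ
sumSubsets zero    f = f []
sumSubsets (suc n) f = sumSubsets n (λ S → f (false ∷ S)) + sumSubsets n (λ S → f (true ∷ S))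

length-filterᵇ-++ : ∀ {A : Set} (P : A → Bool) xs ys →
  length (filterᵇ P (xs List.++ ys)) ≡ length (filterᵇ P xs) + length (filterᵇ P ys)
length-filterᵇ-++ P xs ys = trans (cong length (filter-++ (T? ∘ P) xs ys)) (length-++ (filterᵇ P xs))

length-filterᵇ-map : ∀ {A B : Set} (P : B → Bool) (f : A → B) xs →
  length (filterᵇ P (List.map f xs)) ≡ length (filterᵇ (P ∘ f) xs)
length-filterᵇ-map P f List.[] = refl
length-filterᵇ-map P f (x List.∷ xs) with P (f x)
... | true  = cong suc (length-filterᵇ-map P f xs)
... | false = length-filterᵇ-map P f xs

count≡sumSubsets : ∀ n (P : Subset n → Bool) → count n P ≡ sumSubsets n (λ S → 𝟙 (P S))
count≡sumSubsets zero    P with P []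
... | true  = refl
... | false = refl
count≡sumSubsets (suc n) P = begin
  length (filterᵇ P (List.map (false ∷_) Ss List.++ List.map (true ∷_) Ss))
    ≡⟨ length-filterᵇ-++ P (List.map (false ∷_) Ss) _ ⟩
  length (filterᵇ P (List.map (false ∷_) Ss)) + length (filterᵇ P (List.map (true ∷_) Ss))
    ≡⟨ cong₂ _+_ (trans (length-filterᵇ-map P _ Ss) (count≡sumSubsets n _))
                 (trans (length-filterᵇ-map P _ Ss) (count≡sumSubsets n _)) ⟩
  sumSubsets (suc n) (λ S → 𝟙 (P S)) ∎
  where
  open ≡-Reasoning
  Ss = allSubsets n

sumSubsets-cong : ∀ n {f g : Subset n → ℕ} → (∀ S → f S ≡ g S) → sumSubsets n f ≡ sumSubsets n g
sumSubsets-cong zero    f≡g = f≡g []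
sumSubsets-cong (suc n) f≡g = cong₂ _+_ (sumSubsets-cong n (λ S → f≡g (false ∷ S))) (sumSubsets-cong n (λ S → f≡g (true ∷ S)))

sumSubsets-mono : ∀ n {f g : Subset n → ℕ} → (∀ S → f S ≤ g S) → sumSubsets n f ≤ sumSubsets n g
sumSubsets-mono zero    f≤g = f≤g []
sumSubsets-mono (suc n) f≤g = +-mono-≤ (sumSubsets-mono n (λ S → f≤g (false ∷ S))) (sumSubsets-mono n (λ S → f≤g (true ∷ S)))

sumSubsets-+ : ∀ n (f g : Subset n → ℕ) → sumSubsets n (λ S → f S + g S) ≡ sumSubsets n f + sumSubsets n g
sumSubsets-+ zero    f g = refl
sumSubsets-+ (suc n) f g = trans (cong₂ _+_ (sumSubsets-+ n _ _) (sumSubsets-+ n _ _))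
  (interchange (sumSubsets n (λ S → f (false ∷ S))) (sumSubsets n (λ S → g (false ∷ S))) _ _)

sumSubsets-*ˡ : ∀ n c (f : Subset n → ℕ) → sumSubsets n (λ S → c * f S) ≡ c * sumSubsets n f
sumSubsets-*ˡ zero    c f = refl
sumSubsets-*ˡ (suc n) c f = trans (cong₂ _+_ (sumSubsets-*ˡ n c _) (sumSubsets-*ˡ n c _)) (sym (*-distribˡ-+ c _ _))

sumSubsets-*ʳ : ∀ n (f : Subset n → ℕ) c → sumSubsets n (λ S → f S * c) ≡ sumSubsets n f * c
sumSubsets-*ʳ n f c = trans (sumSubsets-cong n (λ S → *-comm (f S) c)) (trans (sumSubsets-*ˡ n c f) (*-comm c _))

sumSubsets-const : ∀ n c → sumSubsets n (λ _ → c) ≡ 2 ^ n * c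
sumSubsets-const zero    c = sym (+-identityʳ c)
sumSubsets-const (suc n) c = begin
  sumSubsets n (λ _ → c) + sumSubsets n (λ _ → c) ≡⟨ cong₂ _+_ (sumSubsets-const n c) (sumSubsets-const n c) ⟩
  2 ^ n * c + 2 ^ n * c                           ≡⟨ *-distribʳ-+ c (2 ^ n) (2 ^ n) ⟨
  (2 ^ n + 2 ^ n) * c                             ≡⟨ cong (λ t → (2 ^ n + t) * c) (+-identityʳ (2 ^ n)) ⟨
  2 ^ suc n * c                                   ∎
  where open ≡-Reasoning

sumSubsets-zero : ∀ n → sumSubsets n (λ _ → 0) ≡ 0
sumSubsets-zero n = trans (sumSubsets-const n 0) (*-zeroʳ (2 ^ n))

sumSubsets-++ : ∀ p q (f : Subset (p + q) → ℕ) →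
  sumSubsets (p + q) f ≡ sumSubsets p (λ X → sumSubsets q (λ Y → f (X ++ Y)))
sumSubsets-++ zero    q f = refl
sumSubsets-++ (suc p) q f = cong₂ _+_ (sumSubsets-++ p q _) (sumSubsets-++ p q _)

sumSubsets-subst : ∀ {n n'} (n≡n' : n ≡ n') (f : Subset n → ℕ) →
  sumSubsets n f ≡ sumSubsets n' (λ S → f (subst Subset (sym n≡n') S))
sumSubsets-subst refl f = refl

sumSubsets-sumBelow : ∀ n K (f : Subset n → ℕ → ℕ) →
  sumSubsets n (λ S → sumBelow K (f S)) ≡ sumBelow K (λ i → sumSubsets n (λ S → f S i))
sumSubsets-sumBelow n zero    f = sumSubsets-zero n
sumSubsets-sumBelow n (suc K) f =
  trans (sumSubsets-+ n _ _) (cong (λ s → sumSubsets n (λ S → f S 0) + s) (sumSubsets-sumBelow n K (λ S i → f S (suc i))))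

does-true⇒ : ∀ {A : Set} (a? : Dec A) → does a? ≡ true → A
does-true⇒ (yes a) _ = a

any-allFin⁻ : ∀ {n} (p : Fin n → Bool) → any p (allFin n) ≡ true → ∃ λ x → p x ≡ true
any-allFin⁻ p any≡true with satisfied (any⁻ p (allFin _) (Equivalence.from T-≡ any≡true))
... | x , px = x , Equivalence.to T-≡ px

any-allFin⁺ : ∀ {n} (p : Fin n → Bool) x → p x ≡ true → any p (allFin n) ≡ true
any-allFin⁺ p x px = Equivalence.to T-≡ (any⁺ p (lose (∈-allFin x) (Equivalence.from T-≡ px)))

mem : ∀ {n} → Subset n → ℕ → Bool
mem []      i       = false
mem (b ∷ S) zero    = b
mem (b ∷ S) (suc i) = mem S i

mem⇒< : ∀ {n} (S : Subset n) i → mem S i ≡ true → i < n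
mem⇒< (b ∷ S) zero    _ = s≤s z≤n
mem⇒< (b ∷ S) (suc i) e = s≤s (mem⇒< S i e)

mem-++ˡ : ∀ {p q} (X : Subset p) (Y : Subset q) i → i < p → mem (X ++ Y) i ≡ mem X i
mem-++ˡ (b ∷ X) Y zero    _         = refl
mem-++ˡ (b ∷ X) Y (suc i) (s≤s i<p) = mem-++ˡ X Y i i<p

mem-++ʳ : ∀ {p q} (X : Subset p) (Y : Subset q) i → mem (X ++ Y) (p + i) ≡ mem Y i
mem-++ʳ []      Y i = refl
mem-++ʳ (b ∷ X) Y i = mem-++ʳ X Y i

mem-++-congʳ : ∀ {p q q'} (X : Subset p) {Y : Subset q} {Y' : Subset q'} →
  (∀ i → mem Y i ≡ mem Y' i) → ∀ i → mem (X ++ Y) i ≡ mem (X ++ Y') i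
mem-++-congʳ []      Y≗Y' i       = Y≗Y' i
mem-++-congʳ (b ∷ X) Y≗Y' zero    = refl
mem-++-congʳ (b ∷ X) Y≗Y' (suc i) = mem-++-congʳ X Y≗Y' i

mem-subst : ∀ {n n'} (n≡n' : n ≡ n') (S : Subset n) i → mem (subst Subset n≡n' S) i ≡ mem S i
mem-subst refl S i = refl

lookup≡mem : ∀ {n} (S : Subset n) (x : Fin n) → lookup S x ≡ mem S (toℕ x)
lookup≡mem (b ∷ S) Fin.zero    = refl
lookup≡mem (b ∷ S) (Fin.suc x) = lookup≡mem S x

lookup-fromℕ< : ∀ {n} (S : Subset n) {i} (i<n : i < n) → lookup S (fromℕ< i<n) ≡ mem S i
lookup-fromℕ< S i<n = trans (lookup≡mem S _) (cong (mem S) (toℕ-fromℕ< i<n))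

∈ᵇ≡mem : ∀ {n} (S : Subset n) i → (i ∈ᵇ S) ≡ mem S i
∈ᵇ≡mem S i = bool-ext sound complete
  where
  sound : (i ∈ᵇ S) ≡ true → mem S i ≡ true
  sound i∈S with any-allFin⁻ _ i∈S
  ... | x , px = subst (λ j → mem S j ≡ true) (does-true⇒ (toℕ x ℕ.≟ i) (∧-conicalˡ _ _ px))
                   (trans (sym (lookup≡mem S x)) (∧-conicalʳ _ _ px))
  complete : mem S i ≡ true → (i ∈ᵇ S) ≡ true
  complete i∈S = any-allFin⁺ _ (fromℕ< i<n)
    (cong₂ _∧_ (dec-true (toℕ (fromℕ< i<n) ℕ.≟ i) (toℕ-fromℕ< i<n)) (trans (lookup-fromℕ< S i<n) i∈S))
    where i<n = mem⇒< S i i∈S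

sumSubsets-mem : ∀ p j → j < p → 2 * sumSubsets p (λ B → 𝟙 (mem B j)) ≡ 2 ^ p
sumSubsets-mem (suc p) zero    _ =
  cong (2 *_) (cong₂ _+_ (sumSubsets-zero p) (trans (sumSubsets-const p 1) (*-identityʳ (2 ^ p))))
sumSubsets-mem (suc p) (suc j) (s≤s j<p) = begin
  2 * (X + X)        ≡⟨ *-distribˡ-+ 2 X X ⟩
  2 * X + 2 * X      ≡⟨ cong₂ _+_ (sumSubsets-mem p j j<p) (sumSubsets-mem p j j<p) ⟩
  2 ^ p + 2 ^ p      ≡⟨ cong (λ x → 2 ^ p + x) (+-identityʳ (2 ^ p)) ⟨
  2 ^ suc p          ∎
  where
  open ≡-Reasoning
  X = sumSubsets p (λ B → 𝟙 (mem B j))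

-- a - b ∈ S - S, written without subtraction
IsDiff : ∀ {n} → Subset n → ℕ → ℕ → Set
IsDiff S a b = ∃ λ x → ∃ λ y → mem S x ≡ true × mem S y ≡ true × x + b ≡ y + a

+-−-injective : ∀ x y a b → (+ x) ℤ.- (+ y) ≡ (+ a) ℤ.- (+ b) → x + b ≡ y + a
+-−-injective x y a b x-y≡a-b = ℤP.+-injective (begin
  + (x + b)                      ≡⟨ ℤP.pos-+ x b ⟩
  + x ℤ.+ + b                    ≡⟨ regroup (+ x) (+ y) (+ b) ⟩
  (+ x ℤ.- + y) ℤ.+ + y ℤ.+ + b  ≡⟨ cong (λ z → z ℤ.+ + y ℤ.+ + b) x-y≡a-b ⟩
  (+ a ℤ.- + b) ℤ.+ + y ℤ.+ + b  ≡⟨ cancel (+ a) (+ b) (+ y) ⟩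
  + y ℤ.+ + a                    ≡⟨ ℤP.pos-+ y a ⟨
  + (y + a)                      ∎)
  where
  open ≡-Reasoning
  regroup : ∀ X Y B → X ℤ.+ B ≡ (X ℤ.- Y) ℤ.+ Y ℤ.+ B
  regroup = ℤSolver.solve-∀
  cancel : ∀ A B Y → (A ℤ.- B) ℤ.+ Y ℤ.+ B ≡ Y ℤ.+ A
  cancel = ℤSolver.solve-∀

+-−-cong : ∀ x y a b → x + b ≡ y + a → (+ x) ℤ.- (+ y) ≡ (+ a) ℤ.- (+ b)
+-−-cong x y a b x+b≡y+a = begin
  + x ℤ.- + y                    ≡⟨ regroup (+ x) (+ y) (+ b) ⟩
  (+ x ℤ.+ + b) ℤ.- + y ℤ.- + b  ≡⟨ cong (λ z → z ℤ.- + y ℤ.- + b) sums ⟩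
  (+ y ℤ.+ + a) ℤ.- + y ℤ.- + b  ≡⟨ cancel (+ y) (+ a) (+ b) ⟩
  + a ℤ.- + b                    ∎
  where
  open ≡-Reasoning
  sums : + x ℤ.+ + b ≡ + y ℤ.+ + a
  sums = trans (sym (ℤP.pos-+ x b)) (trans (cong +_ x+b≡y+a) (ℤP.pos-+ y a))
  regroup : ∀ X Y B → X ℤ.- Y ≡ (X ℤ.+ B) ℤ.- Y ℤ.- B
  regroup = ℤSolver.solve-∀
  cancel : ∀ Y A B → (Y ℤ.+ A) ℤ.- Y ℤ.- B ≡ A ℤ.- B
  cancel = ℤSolver.solve-∀

inDiff-sound : ∀ {n} (S : Subset n) a b → inDiff S (+ a ℤ.- + b) ≡ true → IsDiff S a b
inDiff-sound S a b a-b∈S-S with any-allFin⁻ _ a-b∈S-S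
... | x , px with any-allFin⁻ _ px
...   | y , pxy = toℕ x , toℕ y
  , trans (sym (lookup≡mem S x)) (∧-conicalˡ _ _ pxy)
  , trans (sym (lookup≡mem S y)) (∧-conicalˡ _ _ py)
  , +-−-injective (toℕ x) (toℕ y) a b (does-true⇒ (_ ℤ.≟ _) (∧-conicalʳ (lookup S y) _ py))
  where py = ∧-conicalʳ (lookup S x) _ pxy

inDiff-complete : ∀ {n} (S : Subset n) a b → IsDiff S a b → inDiff S (+ a ℤ.- + b) ≡ true
inDiff-complete S a b (x , y , x∈S , y∈S , x+b≡y+a) =
  any-allFin⁺ _ (fromℕ< x<n) (any-allFin⁺ _ (fromℕ< y<n)
    (cong₂ _∧_ (trans (lookup-fromℕ< S x<n) x∈S) (cong₂ _∧_ (trans (lookup-fromℕ< S y<n) y∈S)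
      (dec-true (_ ℤ.≟ _) (trans (cong₂ (λ u v → + u ℤ.- + v) (toℕ-fromℕ< x<n) (toℕ-fromℕ< y<n))
                                 (+-−-cong x y a b x+b≡y+a))))))
  where
  x<n = mem⇒< S x x∈S
  y<n = mem⇒< S y y∈S

inDiff-resp : ∀ {n n'} (S : Subset n) (S' : Subset n') a b a' b' →
  (IsDiff S a b → IsDiff S' a' b') → (IsDiff S' a' b' → IsDiff S a b) →
  inDiff S (+ a ℤ.- + b) ≡ inDiff S' (+ a' ℤ.- + b')
inDiff-resp S S' a b a' b' to from = bool-ext
  (λ t → inDiff-complete S' a' b' (to (inDiff-sound S a b t)))
  (λ t → inDiff-complete S a b (from (inDiff-sound S' a' b' t)))

IsDiff-shift : ∀ {n} {S : Subset n} {a b a' b'} → a + b' ≡ a' + b → IsDiff S a b → IsDiff S a' b'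
IsDiff-shift {a = a} {b} {a'} {b'} a+b'≡a'+b (x , y , x∈S , y∈S , x+b≡y+a) =
  x , y , x∈S , y∈S , +-cancelʳ-≡ b (x + b') (y + a') (begin
    x + b' + b    ≡⟨ shuffle x b' b ⟩
    x + b + b'    ≡⟨ cong (_+ b') x+b≡y+a ⟩
    y + a + b'    ≡⟨ +-assoc y a b' ⟩
    y + (a + b')  ≡⟨ cong (_+_ y) a+b'≡a'+b ⟩
    y + (a' + b)  ≡⟨ +-assoc y a' b ⟨
    y + a' + b    ∎)
  where
  open ≡-Reasoning
  shuffle : ∀ x b' b → x + b' + b ≡ x + b + b'
  shuffle = ℕSolver.solve-∀

IsDiff-swap : ∀ {n} {S : Subset n} {a b} → IsDiff S a b → IsDiff S b a
IsDiff-swap (x , y , x∈S , y∈S , x+b≡y+a) = y , x , y∈S , x∈S , sym x+b≡y+a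

IsDiff-cong : ∀ {n n'} (S : Subset n) (S' : Subset n') → (∀ i → mem S i ≡ mem S' i) →
  ∀ {a b} → IsDiff S a b → IsDiff S' a b
IsDiff-cong S S' S≗S' (x , y , x∈S , y∈S , x+b≡y+a) =
  x , y , trans (sym (S≗S' x)) x∈S , trans (sym (S≗S' y)) y∈S , x+b≡y+a

inDiff-shift : ∀ {n} (S : Subset n) a b a' b' → a + b' ≡ a' + b → inDiff S (+ a ℤ.- + b) ≡ inDiff S (+ a' ℤ.- + b')
inDiff-shift S a b a' b' a+b'≡a'+b = inDiff-resp S S a b a' b' (IsDiff-shift {S = S} a+b'≡a'+b) (IsDiff-shift {S = S} (sym a+b'≡a'+b))

inDiff-swap : ∀ {n} (S : Subset n) a b → inDiff S (+ a ℤ.- + b) ≡ inDiff S (+ b ℤ.- + a)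
inDiff-swap S a b = inDiff-resp S S a b b a (IsDiff-swap {S = S}) (IsDiff-swap {S = S})

hasDiff : ∀ {n} → Subset n → ℕ → Bool
hasDiff S d = inDiff S (+ d ℤ.- + 0)

hasDiff-cong : ∀ {n n'} (S : Subset n) (S' : Subset n') → (∀ i → mem S i ≡ mem S' i) → ∀ d → hasDiff S d ≡ hasDiff S' d
hasDiff-cong S S' S≗S' d = inDiff-resp S S' d 0 d 0 (IsDiff-cong S S' S≗S') (IsDiff-cong S' S (λ i → sym (S≗S' i)))

hasDiff-intro : ∀ {n} (S : Subset n) x d → mem S x ≡ true → mem S (x + d) ≡ true → hasDiff S d ≡ true
hasDiff-intro S x d x∈S x+d∈S = inDiff-complete S d 0 (x + d , x , x+d∈S , x∈S , +-identityʳ (x + d))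

hasDiff-elim : ∀ {n} (S : Subset n) d → hasDiff S d ≡ true → ∃ λ x → mem S x ≡ true × mem S (x + d) ≡ true
hasDiff-elim S d d∈S-S with inDiff-sound S d 0 d∈S-S
... | x , y , x∈S , y∈S , x+0≡y+d = y , y∈S , subst (λ z → mem S z ≡ true) (trans (sym (+-identityʳ x)) x+0≡y+d) x∈S

present missing : ∀ {n} → Subset n → ℕ → ℕ → ℕ
present S s K = sumBelow K (λ i → 𝟙 (hasDiff S (s + i)))
missing S s K = sumBelow K (λ i → 𝟙 (not (hasDiff S (s + i))))

present+missing : ∀ {n} (S : Subset n) s K → present S s K + missing S s K ≡ K
present+missing S s K = begin
  present S s K + missing S s K          ≡⟨ sumBelow-+ K _ _ ⟨
  sumBelow K (λ i → 𝟙 (d i) + 𝟙 (not (d i)))  ≡⟨ sumBelow-cong K (λ i _ → 𝟙-+-𝟙-not (d i)) ⟩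
  sumBelow K (λ _ → 1)                   ≡⟨ sumBelow-const K 1 ⟩
  K * 1                                  ≡⟨ *-identityʳ K ⟩
  K                                      ∎
  where
  open ≡-Reasoning
  d = λ i → hasDiff S (s + i)

-- S - S = -D ∪ {0} ∪ D with D its positive part
diffCard≡ : ∀ n₁ (S : Subset (suc n₁)) → mem S 0 ≡ true → diffCard S ≡ present S 1 n₁ + 1 + present S 1 n₁
diffCard≡ n₁ S 0∈S = begin
  diffCard S                                                    ≡⟨ length-filterᵇ-applyUpTo (n₁ + (suc n₁ + 0)) _ (λ i → i) ⟩
  sumBelow (n₁ + (suc n₁ + 0)) c                                ≡⟨ sumBelow-split n₁ (suc n₁ + 0) c ⟩
  sumBelow n₁ c + sumBelow (suc n₁ + 0) (λ i → c (n₁ + i))      ≡⟨ cong₂ _+_ negative nonNegative ⟩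
  P + (1 + P)                                                   ≡⟨ +-assoc P 1 P ⟨
  P + 1 + P                                                     ∎
  where
  open ≡-Reasoning
  P = present S 1 n₁
  c : ℕ → ℕ
  c i = 𝟙 (inDiff S (+ i ℤ.- + n₁))
  negative : sumBelow n₁ c ≡ P
  negative = trans (sumBelow-reverse n₁ c) (sumBelow-cong n₁ (λ i i<n₁ → cong 𝟙 (begin
    inDiff S (+ (n₁ ∸ suc i) ℤ.- + n₁)    ≡⟨ inDiff-swap S (n₁ ∸ suc i) n₁ ⟩
    inDiff S (+ n₁ ℤ.- + (n₁ ∸ suc i))    ≡⟨ inDiff-shift S n₁ (n₁ ∸ suc i) (suc i) 0
                                               (trans (+-identityʳ n₁) (sym (m+[n∸m]≡n i<n₁))) ⟩
    hasDiff S (suc i)                     ∎)))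
  nonNegative : sumBelow (suc n₁ + 0) (λ i → c (n₁ + i)) ≡ 1 + P
  nonNegative = begin
    sumBelow (suc n₁ + 0) (λ i → c (n₁ + i))   ≡⟨ cong (λ K → sumBelow K (λ i → c (n₁ + i))) (+-identityʳ (suc n₁)) ⟩
    sumBelow (suc n₁) (λ i → c (n₁ + i))       ≡⟨ sumBelow-cong (suc n₁) (λ i _ → cong 𝟙
                                                    (inDiff-shift S (n₁ + i) n₁ i 0 (trans (+-identityʳ _) (+-comm n₁ i)))) ⟩
    𝟙 (hasDiff S 0) + P                        ≡⟨ cong (λ b → 𝟙 b + P) (hasDiff-intro S 0 0 0∈S 0∈S) ⟩
    1 + P                                      ∎

diffDeficit≡ : ∀ n₁ (S : Subset (suc n₁)) → mem S 0 ≡ true →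
  (+ (2 * suc n₁)) ℤ.- (+ 1) ℤ.- (+ diffCard S) ≡ + (2 * missing S 1 n₁)
diffDeficit≡ n₁ S 0∈S = begin
  + (2 * suc n₁) ℤ.- + 1 ℤ.- + diffCard S
    ≡⟨ cong₂ (λ a b → + (2 * suc a) ℤ.- + 1 ℤ.- + b) (sym (present+missing S 1 n₁)) (diffCard≡ n₁ S 0∈S) ⟩
  + (2 * suc (P + M)) ℤ.- + 1 ℤ.- + (P + 1 + P)
    ≡⟨ cong (λ a → + a ℤ.- + 1 ℤ.- + (P + 1 + P)) (expand P M) ⟩
  + (1 + (P + 1 + P) + 2 * M) ℤ.- + 1 ℤ.- + (P + 1 + P)
    ≡⟨ cong (λ a → a ℤ.- + 1 ℤ.- + (P + 1 + P)) (trans (ℤP.pos-+ (1 + (P + 1 + P)) (2 * M))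
                                                      (cong (ℤ._+ + (2 * M)) (ℤP.pos-+ 1 (P + 1 + P)))) ⟩
  (+ 1 ℤ.+ + (P + 1 + P) ℤ.+ + (2 * M)) ℤ.- + 1 ℤ.- + (P + 1 + P)
    ≡⟨ cancel (+ 1) (+ (P + 1 + P)) (+ (2 * M)) ⟩
  + (2 * M) ∎
  where
  open ≡-Reasoning
  P = present S 1 n₁
  M = missing S 1 n₁
  expand : ∀ P M → 2 * suc (P + M) ≡ 1 + (P + 1 + P) + 2 * M
  expand = ℕSolver.solve-∀
  cancel : ∀ A D W → (A ℤ.+ D ℤ.+ W) ℤ.- A ℤ.- D ≡ W
  cancel = ℤSolver.solve-∀

Q-event≡ : ∀ n₁ k (S : Subset (suc n₁)) → mem S 0 ≡ true →
  does (((+ (2 * suc n₁)) ℤ.- (+ 1) ℤ.- (+ diffCard S)) ℤ.≟ (+ (2 * k))) ≡ does (missing S 1 n₁ ℕ.≟ k)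
Q-event≡ n₁ k S 0∈S = trans (cong (λ z → does (z ℤ.≟ + (2 * k))) (diffDeficit≡ n₁ S 0∈S))
  (does-⇔ (mk⇔ (λ e → *-cancelˡ-≡ M k 2 (ℤP.+-injective e)) (cong (λ M → + (2 * M))))
    (+ (2 * M) ℤ.≟ + (2 * k)) (M ℕ.≟ k))
  where M = missing S 1 n₁

diffCardUpper≡present : ∀ {n} m (S : Subset n) → diffCardUpper m S ≡ present S m m
diffCardUpper≡present m S = trans (length-filterᵇ-applyUpTo m _ (λ i → i))
  (sumBelow-cong m (λ i _ → cong (λ z → 𝟙 (inDiff S z)) (sym (ℤP.+-identityʳ _))))

g-event≡ : ∀ {n} m k (S : Subset n) →
  does ((+ diffCardUpper m S) ℤ.≟ ((+ m) ℤ.- (+ k))) ≡ does (missing S m m ℕ.≟ k)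
g-event≡ m k S = trans (cong (λ P → does (+ P ℤ.≟ + m ℤ.- + k)) (diffCardUpper≡present m S))
  (does-⇔ (mk⇔ to from) (+ present S m m ℤ.≟ + m ℤ.- + k) (missing S m m ℕ.≟ k))
  where
  P+M≡m = present+missing S m m
  to : + present S m m ≡ + m ℤ.- + k → missing S m m ≡ k
  to e = +-cancelˡ-≡ (present S m m) _ _
    (trans P+M≡m (sym (+-−-injective (present S m m) 0 m k (trans (ℤP.+-identityʳ _) e))))
  from : missing S m m ≡ k → + present S m m ≡ + m ℤ.- + k
  from M≡k = trans (sym (ℤP.+-identityʳ _))
    (+-−-cong (present S m m) 0 m k (trans (cong (_+_ (present S m m)) (sym M≡k)) P+M≡m))

infix 7 _/1+_

_/1+_ : ℕ → ℕ → ℚᵘ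
a /1+ c = mkℚᵘ (+ a) c

/1+-≤ : ∀ {a c b d} → a * suc d ≤ b * suc c → a /1+ c ℚᵘ.≤ b /1+ d
/1+-≤ {a} {c} {b} {d} h = *≤* (subst₂ ℤ._≤_ (ℤP.pos-* a (suc d)) (ℤP.pos-* b (suc c)) (ℤ.+≤+ h))

/1+-< : ∀ {a c b d} → a * suc d < b * suc c → a /1+ c ℚᵘ.< b /1+ d
/1+-< {a} {c} {b} {d} h = *<* (subst₂ ℤ._<_ (ℤP.pos-* a (suc d)) (ℤP.pos-* b (suc c)) (ℤ.+<+ h))

/1+-≃ : ∀ {a c b d} → a * suc d ≡ b * suc c → a /1+ c ℚᵘ.≃ b /1+ d
/1+-≃ {a} {c} {b} {d} h = *≡* (trans (sym (ℤP.pos-* a (suc d))) (trans (cong +_ h) (ℤP.pos-* b (suc c))))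

/1+-+ : ∀ a c b d → (a /1+ c) ℚᵘ.+ (b /1+ d) ℚᵘ.≃ (a * suc d + b * suc c) /1+ (d + c * suc d)
/1+-+ a c b d = *≡* (cong (ℤ._* + suc (d + c * suc d))
  (trans (cong₂ ℤ._+_ (sym (ℤP.pos-* a (suc d))) (sym (ℤP.pos-* b (suc c)))) (sym (ℤP.pos-+ (a * suc d) (b * suc c)))))

/1+-* : ∀ a c b d → (a /1+ c) ℚᵘ.* (b /1+ d) ℚᵘ.≃ (a * b) /1+ (d + c * suc d)
/1+-* a c b d = *≡* (cong (ℤ._* + suc (d + c * suc d)) (sym (ℤP.pos-* a b)))

∣-∣≤-/1+ : ∀ a b e c → a ≤ b + e → b ≤ a + e → ℚᵘ.∣ (a /1+ c) ℚᵘ.- (b /1+ c) ∣ ℚᵘ.≤ e /1+ c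
∣-∣≤-/1+ a b e c a≤b+e b≤a+e = *≤* (subst₂ ℤ._≤_ (sym lhs) (ℤP.pos-* e (suc c * suc c)) (ℤ.+≤+ nat))
  where
  s = suc c
  D = ℤ.∣ + a ℤ.- + b ∣
  factor : ∀ (x y s : ℤ) → x ℤ.* s ℤ.+ (ℤ.- y) ℤ.* s ≡ (x ℤ.- y) ℤ.* s
  factor = ℤSolver.solve-∀
  lhs : + ℤ.∣ + a ℤ.* + s ℤ.+ (ℤ.- + b) ℤ.* + s ∣ ℤ.* + s ≡ + (D * s * s)
  lhs = trans (cong (λ z → + z ℤ.* + s) (trans (cong ℤ.∣_∣ (factor (+ a) (+ b) (+ s))) (ℤP.abs-* (+ a ℤ.- + b) (+ s))))
              (sym (ℤP.pos-* (D * s) s))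
  D≤e : D ≤ e
  D≤e with ≤-total b a
  ... | inj₁ b≤a = subst (_≤ e) (sym (cong ℤ.∣_∣ (trans (ℤP.m-n≡m⊖n a b) (ℤP.⊖-≥ b≤a))))
                         (subst (a ∸ b ≤_) (m+n∸m≡n b e) (∸-monoˡ-≤ b a≤b+e))
  ... | inj₂ a≤b = subst (_≤ e) (sym (trans (cong ℤ.∣_∣ (trans (ℤP.m-n≡m⊖n a b) (ℤP.⊖-≤ a≤b))) (ℤP.∣-i∣≡∣i∣ (+ (b ∸ a)))))
                         (subst (b ∸ a ≤_) (m+n∸m≡n a e) (∸-monoˡ-≤ a b≤a+e))
  nat : D * s * s ≤ e * (s * s)
  nat = subst (D * s * s ≤_) (*-assoc e s s) (*-monoˡ-≤ s (*-monoˡ-≤ s D≤e))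

suc-pred-4^ : ∀ j → suc (ℕ.pred (4 ^ j)) ≡ 4 ^ j
suc-pred-4^ j = suc-pred (4 ^ j) ⦃ m^n≢0 4 j ⦄

toℚᵘ-¾^ : ∀ j → ℚ.toℚᵘ (((+ 3) ℚ./ 4) ^ᵠ j) ℚᵘ.≃ 3 ^ j /1+ ℕ.pred (4 ^ j)
toℚᵘ-¾^ zero    = ℚᵘP.≃-refl
toℚᵘ-¾^ (suc j) = begin
  ℚ.toℚᵘ ((+ 3) ℚ./ 4 ℚ.* ((+ 3) ℚ./ 4) ^ᵠ j)             ≈⟨ ℚP.toℚᵘ-homo-* ((+ 3) ℚ./ 4) (((+ 3) ℚ./ 4) ^ᵠ j) ⟩
  ℚ.toℚᵘ ((+ 3) ℚ./ 4) ℚᵘ.* ℚ.toℚᵘ (((+ 3) ℚ./ 4) ^ᵠ j)   ≈⟨ ℚᵘP.*-cong (ℚP.toℚᵘ-fromℚᵘ (3 /1+ 3)) (toℚᵘ-¾^ j) ⟩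
  (3 /1+ 3) ℚᵘ.* (3 ^ j /1+ ℕ.pred (4 ^ j))              ≈⟨ /1+-* 3 3 (3 ^ j) (ℕ.pred (4 ^ j)) ⟩
  (3 * 3 ^ j) /1+ (ℕ.pred (4 ^ j) + 3 * suc (ℕ.pred (4 ^ j)))
                                                         ≈⟨ /1+-≃ (cong (3 ^ suc j *_) denominators) ⟩
  3 ^ suc j /1+ ℕ.pred (4 ^ suc j)                       ∎
  where
  open ℚᵘP.≃-Reasoning
  denominators : suc (ℕ.pred (4 ^ suc j)) ≡ suc (ℕ.pred (4 ^ j) + 3 * suc (ℕ.pred (4 ^ j)))
  denominators = trans (suc-pred-4^ (suc j)) (trans (cong (4 *_) (sym (suc-pred-4^ j))) (quadruple (ℕ.pred (4 ^ j))))
    where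
    quadruple : ∀ x → 4 * suc x ≡ suc (x + 3 * suc x)
    quadruple = ℕSolver.solve-∀

toℚᵘ-16/9*¾^ : ∀ j → ℚ.toℚᵘ (((+ 16) ℚ./ 9) ℚ.* (((+ 3) ℚ./ 4) ^ᵠ (suc j ℕ.+ 1))) ℚᵘ.≃ 3 ^ j /1+ ℕ.pred (4 ^ j)
toℚᵘ-16/9*¾^ j = chain
  where
  e = suc j + 1
  e≡ : e ≡ suc (suc j)
  e≡ = +-comm (suc j) 1
  regroup : ∀ x y → 16 * (3 * (3 * x)) * y ≡ x * (9 * (4 * (4 * y)))
  regroup = ℕSolver.solve-∀
  ninefold : ∀ x → suc (x + 8 * suc x) ≡ 9 * suc x
  ninefold = ℕSolver.solve-∀
  cross : 16 * 3 ^ e * suc (ℕ.pred (4 ^ j)) ≡ 3 ^ j * suc (ℕ.pred (4 ^ e) + 8 * suc (ℕ.pred (4 ^ e)))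
  cross = begin
    16 * 3 ^ e * suc (ℕ.pred (4 ^ j))         ≡⟨ cong₂ (λ u v → 16 * 3 ^ u * v) e≡ (suc-pred-4^ j) ⟩
    16 * (3 * (3 * 3 ^ j)) * 4 ^ j             ≡⟨ regroup (3 ^ j) (4 ^ j) ⟩
    3 ^ j * (9 * (4 * (4 * 4 ^ j)))            ≡⟨ cong (λ u → 3 ^ j * (9 * u)) (trans (suc-pred-4^ e) (cong (4 ^_) e≡)) ⟨
    3 ^ j * (9 * suc (ℕ.pred (4 ^ e)))         ≡⟨ cong (3 ^ j *_) (ninefold (ℕ.pred (4 ^ e))) ⟨
    3 ^ j * suc (ℕ.pred (4 ^ e) + 8 * suc (ℕ.pred (4 ^ e))) ∎
    where open ≡-Reasoning
  chain : ℚ.toℚᵘ (((+ 16) ℚ./ 9) ℚ.* (((+ 3) ℚ./ 4) ^ᵠ (suc j ℕ.+ 1))) ℚᵘ.≃ 3 ^ j /1+ ℕ.pred (4 ^ j)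
  chain = begin
    ℚ.toℚᵘ ((+ 16) ℚ./ 9 ℚ.* ((+ 3) ℚ./ 4) ^ᵠ (suc j + 1))       ≈⟨ ℚP.toℚᵘ-homo-* ((+ 16) ℚ./ 9) (((+ 3) ℚ./ 4) ^ᵠ (suc j + 1)) ⟩
    ℚ.toℚᵘ ((+ 16) ℚ./ 9) ℚᵘ.* ℚ.toℚᵘ (((+ 3) ℚ./ 4) ^ᵠ (suc j + 1))
                                                                ≈⟨ ℚᵘP.*-cong (ℚP.toℚᵘ-fromℚᵘ (16 /1+ 8)) (toℚᵘ-¾^ (suc j + 1)) ⟩
    (16 /1+ 8) ℚᵘ.* (3 ^ e /1+ ℕ.pred (4 ^ e))                  ≈⟨ /1+-* 16 8 (3 ^ e) (ℕ.pred (4 ^ e)) ⟩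
    (16 * 3 ^ e) /1+ (ℕ.pred (4 ^ e) + 8 * suc (ℕ.pred (4 ^ e))) ≈⟨ /1+-≃ cross ⟩
    3 ^ j /1+ ℕ.pred (4 ^ j)                                    ∎
    where open ℚᵘP.≃-Reasoning

toℚᵘ-condProb : ∀ n (A B : Subset n → Bool) c → count n B ≡ suc c →
  ℚ.toℚᵘ (condProb n A B) ℚᵘ.≃ sumSubsets n (λ S → 𝟙 (A S ∧ B S)) /1+ c
toℚᵘ-condProb n A B c #B≡ rewrite #B≡ | count≡sumSubsets n (λ S → A S ∧ B S) = ℚP.toℚᵘ-fromℚᵘ _

toℚᵘ-∣-∣-cong : ∀ {X Y : ℚ} {x y : ℚᵘ} → ℚ.toℚᵘ X ℚᵘ.≃ x → ℚ.toℚᵘ Y ℚᵘ.≃ y →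
  ℚ.toℚᵘ (ℚ.∣ X ℚ.- Y ∣) ℚᵘ.≃ ℚᵘ.∣ x ℚᵘ.- y ∣
toℚᵘ-∣-∣-cong {X} {Y} X≃x Y≃y = ℚᵘP.≃-trans (ℚP.toℚᵘ-homo-∣-∣ (X ℚ.- Y)) (ℚᵘP.∣-∣-cong
  (ℚᵘP.≃-trans (ℚP.toℚᵘ-homo-+ X (ℚ.- Y)) (ℚᵘP.+-cong X≃x (ℚᵘP.≃-trans (ℚP.toℚᵘ-homo‿- Y) (ℚᵘP.-‿cong Y≃y)))))

module _ {m r : ℕ} (A : Subset m) (M : Subset r) (B : Subset m) where

  private
    S  = A ++ (M ++ B)
    S' = A ++ B

  -- a difference of length ≥ m + r can only join a point of A to a point of B
  hasDiff-++-middle : ∀ i → hasDiff (A ++ (M ++ B)) (m + r + i) ≡ hasDiff (A ++ B) (m + i)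
  hasDiff-++-middle i = bool-ext
    (λ t → let (x , x∈S , x+d∈S) = hasDiff-elim S (m + r + i) t in shorten x x∈S x+d∈S)
    (λ t → let (x , x∈S' , x+d∈S') = hasDiff-elim S' (m + i) t in lengthen x x∈S' x+d∈S')
    where
    reassoc : ∀ x m r i → x + (m + r + i) ≡ m + (r + (x + i))
    reassoc = ℕSolver.solve-∀
    via-S : ∀ x → x + (m + r + i) ≡ m + (r + (x + i))
    via-S x = reassoc x m r i
    via-S' : ∀ x → x + (m + i) ≡ m + (x + i)
    via-S' x = trans (cong (λ j → x + (j + i)) (sym (+-identityʳ m))) (reassoc x m 0 i)
    x<m : ∀ x j → m + (j + (x + i)) < m + (j + m) → x < m
    x<m x j lt = m+n≤o⇒m≤o (suc x) (+-cancelˡ-< j (x + i) m (+-cancelˡ-< m _ _ lt))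
    A∩S : ∀ x → x < m → mem S x ≡ mem S' x
    A∩S x x<m = trans (mem-++ˡ A (M ++ B) x x<m) (sym (mem-++ˡ A B x x<m))
    B∩S : ∀ x → mem S (x + (m + r + i)) ≡ mem B (x + i)
    B∩S x = trans (cong (mem S) (via-S x)) (trans (mem-++ʳ A (M ++ B) (r + (x + i))) (mem-++ʳ M B (x + i)))
    B∩S' : ∀ x → mem S' (x + (m + i)) ≡ mem B (x + i)
    B∩S' x = trans (cong (mem S') (via-S' x)) (mem-++ʳ A B (x + i))
    shorten : ∀ x → mem S x ≡ true → mem S (x + (m + r + i)) ≡ true → hasDiff S' (m + i) ≡ true
    shorten x x∈S x+d∈S = hasDiff-intro S' x (m + i)
      (trans (sym (A∩S x (x<m x r (subst (_< m + (r + m)) (via-S x) (mem⇒< S _ x+d∈S))))) x∈S)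
      (trans (B∩S' x) (trans (sym (B∩S x)) x+d∈S))
    lengthen : ∀ x → mem S' x ≡ true → mem S' (x + (m + i)) ≡ true → hasDiff S (m + r + i) ≡ true
    lengthen x x∈S' x+d∈S' = hasDiff-intro S x (m + r + i)
      (trans (A∩S x (x<m x 0 (subst (_< m + m) (via-S' x) (mem⇒< S' _ x+d∈S')))) x∈S')
      (trans (B∩S x) (trans (sym (B∩S' x)) x+d∈S'))

sumSubsets-++-++ : ∀ p q (f : Subset (p + (q + p)) → ℕ) →
  sumSubsets (p + (q + p)) f ≡ sumSubsets p (λ A → sumSubsets q (λ M → sumSubsets p (λ B → f (A ++ (M ++ B)))))
sumSubsets-++-++ p q f = trans (sumSubsets-++ p (q + p) f) (sumSubsets-cong p (λ A → sumSubsets-++ q p _))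

sumSubsets-mono₃ : ∀ p q {f g h : Subset p → Subset q → Subset p → ℕ} →
  (∀ A M B → f A M B ≤ g A M B + h A M B) →
  sumSubsets p (λ A → sumSubsets q (λ M → sumSubsets p (λ B → f A M B))) ≤
  sumSubsets p (λ A → sumSubsets q (λ M → sumSubsets p (λ B → g A M B))) +
  sumSubsets p (λ A → sumSubsets q (λ M → sumSubsets p (λ B → h A M B)))
sumSubsets-mono₃ p q f≤g+h = ≤-trans
  (sumSubsets-mono p (λ A → sumSubsets-mono q (λ M → sumSubsets-mono p (f≤g+h A M))))
  (≤-reflexive (trans (sumSubsets-cong p (λ A → trans (sumSubsets-cong q (λ M → sumSubsets-+ p _ _)) (sumSubsets-+ q _ _)))
                      (sumSubsets-+ p _ _)))

sumSubsets-ignore-middle : ∀ p q (f : Subset p → Subset p → ℕ) →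
  sumSubsets p (λ A → sumSubsets q (λ M → sumSubsets p (λ B → f A B))) ≡ 2 ^ q * sumSubsets p (λ A → sumSubsets p (λ B → f A B))
sumSubsets-ignore-middle p q f = trans (sumSubsets-cong p (λ A → sumSubsets-const q (sumSubsets p (λ B → f A B))))
                                       (sumSubsets-*ˡ p (2 ^ q) (λ A → sumSubsets p (λ B → f A B)))

4*x≡2^j⇒nonzero : ∀ x j → 4 * x ≡ 2 ^ j → ∃ λ c → x ≡ suc c
4*x≡2^j⇒nonzero (suc c) j _     = c , refl
4*x≡2^j⇒nonzero zero    j 0≡2^j = ⊥-elim (<⇒≢ (m^n>0 2 j) 0≡2^j)

-- With n = m + r + m, a subset S = A ++ M ++ B of [n] satisfying the condition of Q lies in the event of Q
-- iff A ++ B lies in the event of g, unless S - S misses one of 1, …, m₁ + r.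
module Comparison (m₁ r k : ℕ) where

  m n : ℕ
  m = suc m₁
  n = m + (r + m)

  Q-event Q-cond : Subset n → Bool
  Q-event S = does (((+ (2 * n)) ℤ.- (+ 1) ℤ.- (+ diffCard S)) ℤ.≟ (+ (2 * k)))
  Q-cond S = (0 ∈ᵇ S) ∧ ((n ∸ 1) ∈ᵇ S)

  g-event g-cond : Subset (2 * m) → Bool
  g-event S = does ((+ diffCardUpper m S) ℤ.≟ ((+ m) ℤ.- (+ k)))
  g-cond S = (0 ∈ᵇ S) ∧ ((2 * m ∸ 1) ∈ᵇ S)

  _++′_ : Subset m → Subset m → Subset (2 * m)
  A ++′ B = A ++ subst Subset (sym (+-identityʳ m)) B

  sumSubsets-++′ : ∀ (f : Subset (2 * m) → ℕ) → sumSubsets (2 * m) f ≡ sumSubsets m (λ A → sumSubsets m (λ B → f (A ++′ B)))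
  sumSubsets-++′ f = trans (sumSubsets-++ m (m + 0) f) (sumSubsets-cong m (λ A → sumSubsets-subst (+-identityʳ m) (λ B → f (A ++ B))))

  sumSubsets-++′-middle : ∀ (f : Subset (2 * m) → ℕ) →
    sumSubsets m (λ A → sumSubsets r (λ M → sumSubsets m (λ B → f (A ++′ B)))) ≡ 2 ^ r * sumSubsets (2 * m) f
  sumSubsets-++′-middle f = trans (sumSubsets-ignore-middle m r (λ A B → f (A ++′ B))) (cong (2 ^ r *_) (sym (sumSubsets-++′ f)))

  Q-cond-++ : ∀ (A : Subset m) (M : Subset r) (B : Subset m) → Q-cond (A ++ (M ++ B)) ≡ mem A 0 ∧ mem B m₁
  Q-cond-++ A M B = cong₂ _∧_
    (trans (∈ᵇ≡mem S 0) (mem-++ˡ A (M ++ B) 0 (s≤s z≤n)))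
    (trans (∈ᵇ≡mem S (n ∸ 1)) (trans (cong (mem S) (last m₁ r)) (trans (mem-++ʳ A (M ++ B) (r + m₁)) (mem-++ʳ M B m₁))))
    where
    S = A ++ (M ++ B)
    last : ∀ m₁ r → m₁ + (r + suc m₁) ≡ suc m₁ + (r + m₁)
    last = ℕSolver.solve-∀

  g-cond-++′ : ∀ A B → g-cond (A ++′ B) ≡ mem A 0 ∧ mem B m₁
  g-cond-++′ A B = cong₂ _∧_
    (trans (∈ᵇ≡mem S 0) (mem-++ˡ A _ 0 (s≤s z≤n)))
    (trans (∈ᵇ≡mem S (2 * m ∸ 1)) (trans (cong (mem S) (last m₁)) (trans (mem-++ʳ A _ m₁) (mem-subst (sym (+-identityʳ m)) B m₁))))
    where
    S = A ++′ B
    last : ∀ m₁ → m₁ + (suc m₁ + 0) ≡ suc m₁ + m₁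
    last = ℕSolver.solve-∀

  missingSmall : Subset n → ℕ
  missingSmall S = sumBelow (m₁ + r) (λ i → 𝟙 (not (hasDiff S (suc i)) ∧ Q-cond S))

  missing-++-middle : ∀ (A : Subset m) (M : Subset r) (B : Subset m) →
    missing (A ++ (M ++ B)) 1 (m₁ + (r + m)) ≡ missing (A ++ (M ++ B)) 1 (m₁ + r) + missing (A ++′ B) m m
  missing-++-middle A M B = begin
    missing S 1 (m₁ + (r + m))                              ≡⟨ cong (missing S 1) (+-assoc m₁ r m) ⟨
    missing S 1 (m₁ + r + m)                                ≡⟨ sumBelow-split (m₁ + r) m _ ⟩
    missing S 1 (m₁ + r) + missing S (m + r) m              ≡⟨ cong (_+_ (missing S 1 (m₁ + r)))
                                                                 (sumBelow-cong m (λ i _ → cong (λ b → 𝟙 (not b)) (upper i))) ⟩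
    missing S 1 (m₁ + r) + missing (A ++′ B) m m            ∎
    where
    open ≡-Reasoning
    S = A ++ (M ++ B)
    upper : ∀ i → hasDiff S (m + r + i) ≡ hasDiff (A ++′ B) (m + i)
    upper i = trans (hasDiff-++-middle A M B i)
      (hasDiff-cong (A ++ B) (A ++′ B) (mem-++-congʳ A (λ j → sym (mem-subst (sym (+-identityʳ m)) B j))) (m + i))

  cond-agree : ∀ (A : Subset m) (M : Subset r) (B : Subset m) → Q-cond (A ++ (M ++ B)) ≡ g-cond (A ++′ B)
  cond-agree A M B = trans (Q-cond-++ A M B) (sym (g-cond-++′ A B))

  events-agree : ∀ (A : Subset m) (M : Subset r) (B : Subset m) → Q-cond (A ++ (M ++ B)) ≡ true →
    missingSmall (A ++ (M ++ B)) ≡ 0 → Q-event (A ++ (M ++ B)) ≡ g-event (A ++′ B)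
  events-agree A M B cond noGaps = begin
    Q-event S                                  ≡⟨ Q-event≡ (m₁ + (r + m)) k S 0∈S ⟩
    does (missing S 1 (m₁ + (r + m)) ℕ.≟ k)    ≡⟨ cong (λ x → does (x ℕ.≟ k)) (missing-++-middle A M B) ⟩
    does (missing S 1 (m₁ + r) + missing (A ++′ B) m m ℕ.≟ k)
                                               ≡⟨ cong (λ x → does (x + missing (A ++′ B) m m ℕ.≟ k)) noSmallMissing ⟩
    does (missing (A ++′ B) m m ℕ.≟ k)         ≡⟨ g-event≡ m k (A ++′ B) ⟨
    g-event (A ++′ B)                          ∎
    where
    open ≡-Reasoning
    S = A ++ (M ++ B)
    0∈S : mem S 0 ≡ true
    0∈S = trans (mem-++ˡ A (M ++ B) 0 (s≤s z≤n)) (∧-conicalˡ _ _ (trans (sym (Q-cond-++ A M B)) cond))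
    noSmallMissing : missing S 1 (m₁ + r) ≡ 0
    noSmallMissing = trans (sumBelow-cong (m₁ + r) (λ i _ → cong 𝟙 (begin
      not (hasDiff S (suc i))               ≡⟨ ∧-identityʳ _ ⟨
      not (hasDiff S (suc i)) ∧ true        ≡⟨ cong (not (hasDiff S (suc i)) ∧_) cond ⟨
      not (hasDiff S (suc i)) ∧ Q-cond S    ∎))) noGaps

  #Q #Q-cond #missingSmall : ℕ
  #Q       = sumSubsets n (λ S → 𝟙 (Q-event S ∧ Q-cond S))
  #Q-cond  = sumSubsets n (λ S → 𝟙 (Q-cond S))
  #missingSmall = sumSubsets n missingSmall

  #g #g-cond : ℕ
  #g      = sumSubsets (2 * m) (λ S → 𝟙 (g-event S ∧ g-cond S))
  #g-cond = sumSubsets (2 * m) (λ S → 𝟙 (g-cond S))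

  private
    Σ[_] : (Subset m → Subset r → Subset m → ℕ) → ℕ
    Σ[ f ] = sumSubsets m (λ A → sumSubsets r (λ M → sumSubsets m (λ B → f A M B)))

    Q-ind g-ind : Subset m → Subset r → Subset m → ℕ
    Q-ind A M B = 𝟙 (Q-event (A ++ (M ++ B)) ∧ Q-cond (A ++ (M ++ B)))
    g-ind A M B = 𝟙 (g-event (A ++′ B) ∧ g-cond (A ++′ B))

    small : Subset m → Subset r → Subset m → ℕ
    small A M B = missingSmall (A ++ (M ++ B))

    Q-ind≤g-ind+small : ∀ A M B → Q-ind A M B ≤ g-ind A M B + small A M B
    Q-ind≤g-ind+small A M B =
      subst (λ c → Q-ind A M B ≤ 𝟙 (g-event (A ++′ B) ∧ c) + small A M B) (cond-agree A M B)
        (𝟙-∧-≤-+ _ _ (Q-cond (A ++ (M ++ B))) _ (events-agree A M B))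

    g-ind≤Q-ind+small : ∀ A M B → g-ind A M B ≤ Q-ind A M B + small A M B
    g-ind≤Q-ind+small A M B =
      subst (λ c → 𝟙 (g-event (A ++′ B) ∧ c) ≤ Q-ind A M B + small A M B) (cond-agree A M B)
        (𝟙-∧-≤-+ _ _ (Q-cond (A ++ (M ++ B))) _ (λ c g → sym (events-agree A M B c g)))

    #Q≡ : #Q ≡ Σ[ Q-ind ]
    #Q≡ = sumSubsets-++-++ m r (λ S → 𝟙 (Q-event S ∧ Q-cond S))

    #g≡ : 2 ^ r * #g ≡ Σ[ g-ind ]
    #g≡ = sym (sumSubsets-++′-middle (λ S → 𝟙 (g-event S ∧ g-cond S)))

    #missingSmall≡ : #missingSmall ≡ Σ[ small ]
    #missingSmall≡ = sumSubsets-++-++ m r missingSmall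

  #Q≤#g+#missingSmall : #Q ≤ 2 ^ r * #g + #missingSmall
  #Q≤#g+#missingSmall = subst₂ _≤_ (sym #Q≡) (sym (cong₂ _+_ #g≡ #missingSmall≡)) (sumSubsets-mono₃ m r {Q-ind} {g-ind} {small} Q-ind≤g-ind+small)

  #g≤#Q+#missingSmall : 2 ^ r * #g ≤ #Q + #missingSmall
  #g≤#Q+#missingSmall = subst₂ _≤_ (sym #g≡) (sym (cong₂ _+_ #Q≡ #missingSmall≡)) (sumSubsets-mono₃ m r {g-ind} {Q-ind} {small} g-ind≤Q-ind+small)

  #Q-cond≡ : #Q-cond ≡ 2 ^ r * #g-cond
  #Q-cond≡ = begin
    #Q-cond                                           ≡⟨ sumSubsets-++-++ m r (λ S → 𝟙 (Q-cond S)) ⟩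
    Σ[ (λ A M B → 𝟙 (Q-cond (A ++ (M ++ B)))) ]       ≡⟨ sumSubsets-cong m (λ A → sumSubsets-cong r (λ M →
                                                           sumSubsets-cong m (λ B → cong 𝟙 (cond-agree A M B)))) ⟩
    Σ[ (λ A M B → 𝟙 (g-cond (A ++′ B))) ]             ≡⟨ sumSubsets-++′-middle (λ S → 𝟙 (g-cond S)) ⟩
    2 ^ r * #g-cond                                   ∎
    where open ≡-Reasoning

  4*#g-cond≡ : 4 * #g-cond ≡ 2 ^ m * 2 ^ m
  4*#g-cond≡ = begin
    4 * #g-cond
      ≡⟨ cong (4 *_) (trans (sumSubsets-++′ (λ S → 𝟙 (g-cond S)))
           (sumSubsets-cong m (λ A → sumSubsets-cong m (λ B → trans (cong 𝟙 (g-cond-++′ A B)) (𝟙-∧ (mem A 0) (mem B m₁)))))) ⟩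
    4 * sumSubsets m (λ A → sumSubsets m (λ B → 𝟙 (mem A 0) * 𝟙 (mem B m₁)))
      ≡⟨ cong (4 *_) (sumSubsets-cong m (λ A → sumSubsets-*ˡ m (𝟙 (mem A 0)) (λ B → 𝟙 (mem B m₁)))) ⟩
    4 * sumSubsets m (λ A → 𝟙 (mem A 0) * Y)
      ≡⟨ cong (4 *_) (trans (sumSubsets-cong m (λ A → *-comm (𝟙 (mem A 0)) Y)) (sumSubsets-*ˡ m Y (λ A → 𝟙 (mem A 0)))) ⟩
    4 * (Y * X)
      ≡⟨ regroup X Y ⟩
    (2 * X) * (2 * Y)
      ≡⟨ cong₂ _*_ (sumSubsets-mem m 0 (s≤s z≤n)) (sumSubsets-mem m m₁ ≤-refl) ⟩
    2 ^ m * 2 ^ m ∎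
    where
    open ≡-Reasoning
    X = sumSubsets m (λ A → 𝟙 (mem A 0))
    Y = sumSubsets m (λ B → 𝟙 (mem B m₁))
    regroup : ∀ X Y → 4 * (Y * X) ≡ (2 * X) * (2 * Y)
    regroup = ℕSolver.solve-∀

  4*#Q-cond≡ : 4 * #Q-cond ≡ 2 ^ n
  4*#Q-cond≡ = begin
    4 * #Q-cond                  ≡⟨ cong (4 *_) #Q-cond≡ ⟩
    4 * (2 ^ r * #g-cond)        ≡⟨ *-comm 4 (2 ^ r * #g-cond) ⟩
    2 ^ r * #g-cond * 4          ≡⟨ *-assoc (2 ^ r) #g-cond 4 ⟩
    2 ^ r * (#g-cond * 4)        ≡⟨ cong (2 ^ r *_) (trans (*-comm #g-cond 4) 4*#g-cond≡) ⟩
    2 ^ r * (2 ^ m * 2 ^ m)      ≡⟨ cong (2 ^ r *_) (^-distribˡ-+-* 2 m m) ⟨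
    2 ^ r * 2 ^ (m + m)          ≡⟨ ^-distribˡ-+-* 2 r (m + m) ⟨
    2 ^ (r + (m + m))            ≡⟨ cong (2 ^_) (exponent m r) ⟩
    2 ^ n                        ∎
    where
    open ≡-Reasoning
    exponent : ∀ m r → r + (m + m) ≡ m + (r + m)
    exponent = ℕSolver.solve-∀

  #Q-cond-nonzero : ∃ λ c → #Q-cond ≡ suc c
  #Q-cond-nonzero = 4*x≡2^j⇒nonzero #Q-cond n 4*#Q-cond≡

  toℚᵘ-Q : ∀ c → #Q-cond ≡ suc c → ℚ.toℚᵘ (Q n (+ (2 * k))) ℚᵘ.≃ #Q /1+ c
  toℚᵘ-Q c C≡ = toℚᵘ-condProb n Q-event Q-cond c (trans (count≡sumSubsets n Q-cond) C≡)

  toℚᵘ-g : ∀ c → #Q-cond ≡ suc c → ℚ.toℚᵘ (g (+ k) m) ℚᵘ.≃ (2 ^ r * #g) /1+ c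
  toℚᵘ-g c C≡ with 4*x≡2^j⇒nonzero #g-cond (m + m) (trans 4*#g-cond≡ (sym (^-distribˡ-+-* 2 m m)))
  ... | cg , Cg≡ = ℚᵘP.≃-trans (toℚᵘ-condProb (2 * m) g-event g-cond cg (trans (count≡sumSubsets (2 * m) g-cond) Cg≡))
    (/1+-≃ (trans (cong (#g *_) (trans (sym C≡) (trans #Q-cond≡ (cong (2 ^ r *_) Cg≡)))) (swap #g (2 ^ r) (suc cg))))
    where
    swap : ∀ x y z → x * (y * z) ≡ y * x * z
    swap = ℕSolver.solve-∀

disjoint : ∀ {p} → Subset p → Subset p → Bool
disjoint []      []      = true
disjoint (x ∷ X) (y ∷ Y) = not (x ∧ y) ∧ disjoint X Y

disjoint-intro : ∀ {p} (X Y : Subset p) → (∀ i → mem X i ≡ true → mem Y i ≡ true → ⊥) → disjoint X Y ≡ true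
disjoint-intro []           []           _       = refl
disjoint-intro (true  ∷ X) (true  ∷ Y) X∩Y≡∅ = ⊥-elim (X∩Y≡∅ 0 refl refl)
disjoint-intro (true  ∷ X) (false ∷ Y) X∩Y≡∅ = disjoint-intro X Y (λ i → X∩Y≡∅ (suc i))
disjoint-intro (false ∷ X) (y     ∷ Y) X∩Y≡∅ = disjoint-intro X Y (λ i → X∩Y≡∅ (suc i))

disjoint-elim : ∀ {p} (X Y : Subset p) → disjoint X Y ≡ false → ∃ λ i → mem X i ≡ true × mem Y i ≡ true
disjoint-elim []          []          ()
disjoint-elim (true  ∷ X) (true  ∷ Y) _ = 0 , refl , refl
disjoint-elim (true  ∷ X) (false ∷ Y) e with disjoint-elim X Y e
... | i , i∈X , i∈Y = suc i , i∈X , i∈Y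
disjoint-elim (false ∷ X) (y     ∷ Y) e with disjoint-elim X Y e
... | i , i∈X , i∈Y = suc i , i∈X , i∈Y

-- each coordinate lies in X only, in Y only, or in neither
sumSubsets-disjoint-suc : ∀ p (h : Subset p → Bool) →
  sumSubsets (suc p) (λ X → sumSubsets (suc p) (λ Y → 𝟙 (disjoint X Y ∧ h (tail Y)))) ≡
  3 * sumSubsets p (λ X → sumSubsets p (λ Y → 𝟙 (disjoint X Y ∧ h Y)))
sumSubsets-disjoint-suc p h = begin
  sumSubsets p (λ X → N X + N X) + sumSubsets p (λ X → N X + sumSubsets p (λ _ → 0))
    ≡⟨ cong₂ _+_ (sumSubsets-+ p N N) (sumSubsets-cong p (λ X → trans (cong (_+_ (N X)) (sumSubsets-zero p)) (+-identityʳ (N X)))) ⟩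
  (T + T) + T
    ≡⟨ triple T ⟩
  3 * T ∎
  where
  open ≡-Reasoning
  N : Subset p → ℕ
  N X = sumSubsets p (λ Y → 𝟙 (disjoint X Y ∧ h Y))
  T = sumSubsets p N
  triple : ∀ T → (T + T) + T ≡ 3 * T
  triple = ℕSolver.solve-∀

#disjoint : ∀ p → sumSubsets p (λ X → sumSubsets p (λ Y → 𝟙 (disjoint X Y))) ≡ 3 ^ p
#disjoint p = trans (sumSubsets-cong p (λ X → sumSubsets-cong p (λ Y → cong 𝟙 (sym (∧-identityʳ (disjoint X Y))))))
                    (#disjoint∧true p)
  where
  #disjoint∧true : ∀ p → sumSubsets p (λ X → sumSubsets p (λ Y → 𝟙 (disjoint X Y ∧ true))) ≡ 3 ^ p
  #disjoint∧true zero    = refl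
  #disjoint∧true (suc p) = trans (sumSubsets-disjoint-suc p (λ _ → true)) (cong (3 *_) (#disjoint∧true p))

#disjoint-last : ∀ p → sumSubsets (suc p) (λ X → sumSubsets (suc p) (λ Y → 𝟙 (disjoint X Y ∧ mem Y p))) ≡ 3 ^ p
#disjoint-last zero    = refl
#disjoint-last (suc p) = trans (sumSubsets-disjoint-suc (suc p) (λ Y → mem Y p)) (cong (3 *_) (#disjoint-last p))

#missingDiff : ℕ → ℕ → ℕ
#missingDiff n d = sumSubsets n (λ S → 𝟙 (not (hasDiff S d)))

-- T blocks of length 2d followed by R points
blocks : ℕ → ℕ → ℕ → ℕ
blocks d zero    R = R
blocks d (suc T) R = (d + d) + blocks d T R

blocks≡ : ∀ d T R → blocks d T R ≡ T * (d + d) + R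
blocks≡ d zero    R = refl
blocks≡ d (suc T) R = trans (cong (_+_ (d + d)) (blocks≡ d T R)) (sym (+-assoc (d + d) (T * (d + d)) R))

hasDiff-++ʳ : ∀ {p q} (X : Subset p) (Y : Subset q) d → hasDiff Y d ≡ true → hasDiff (X ++ Y) d ≡ true
hasDiff-++ʳ {p} X Y d d∈Y-Y with hasDiff-elim Y d d∈Y-Y
... | y , y∈Y , y+d∈Y = hasDiff-intro (X ++ Y) (p + y) d (trans (mem-++ʳ X Y y) y∈Y)
  (trans (cong (mem (X ++ Y)) (+-assoc p y d)) (trans (mem-++ʳ X Y (y + d)) y+d∈Y))

hasDiff-++-halves : ∀ {d q} (X₁ X₂ : Subset d) (Y : Subset q) → disjoint X₁ X₂ ≡ false → hasDiff ((X₁ ++ X₂) ++ Y) d ≡ true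
hasDiff-++-halves {d} X₁ X₂ Y e with disjoint-elim X₁ X₂ e
... | i , i∈X₁ , i∈X₂ = hasDiff-intro S i d
  (trans (mem-++ˡ (X₁ ++ X₂) Y i (≤-trans i<d (m≤m+n d d))) (trans (mem-++ˡ X₁ X₂ i i<d) i∈X₁))
  (trans (cong (mem S) (+-comm i d))
    (trans (mem-++ˡ (X₁ ++ X₂) Y (d + i) (+-monoʳ-< d (mem⇒< X₂ i i∈X₂))) (trans (mem-++ʳ X₁ X₂ i) i∈X₂)))
  where
  S = (X₁ ++ X₂) ++ Y
  i<d = mem⇒< X₁ i i∈X₁

#missingDiff-blocks : ∀ d T R → #missingDiff (blocks d T R) d ≤ 3 ^ (T * d) * 2 ^ R
#missingDiff-blocks d zero    R = begin
  #missingDiff R d            ≤⟨ sumSubsets-mono R (λ S → 𝟙≤1 (not (hasDiff S d))) ⟩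
  sumSubsets R (λ _ → 1)      ≡⟨ sumSubsets-const R 1 ⟩
  2 ^ R * 1                   ≡⟨ *-comm (2 ^ R) 1 ⟩
  1 * 2 ^ R                   ∎
  where open ≤-Reasoning
#missingDiff-blocks d (suc T) R = begin
  #missingDiff (d + d + L) d
    ≡⟨ trans (sumSubsets-++ (d + d) L _) (sumSubsets-++ d d _) ⟩
  sumSubsets d (λ X₁ → sumSubsets d (λ X₂ → sumSubsets L (λ Y → 𝟙 (not (hasDiff ((X₁ ++ X₂) ++ Y) d)))))
    ≤⟨ sumSubsets-mono d (λ X₁ → sumSubsets-mono d (λ X₂ → sumSubsets-mono L (λ Y →
         𝟙-not-≤-* _ (disjoint X₁ X₂) (hasDiff Y d) (hasDiff-++-halves X₁ X₂ Y) (hasDiff-++ʳ (X₁ ++ X₂) Y d)))) ⟩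
  sumSubsets d (λ X₁ → sumSubsets d (λ X₂ → sumSubsets L (λ Y → 𝟙 (disjoint X₁ X₂) * 𝟙 (not (hasDiff Y d)))))
    ≡⟨ sumSubsets-cong d (λ X₁ → trans (sumSubsets-cong d (λ X₂ → sumSubsets-*ˡ L (𝟙 (disjoint X₁ X₂)) _))
                                       (sumSubsets-*ʳ d (λ X₂ → 𝟙 (disjoint X₁ X₂)) _)) ⟩
  sumSubsets d (λ X₁ → sumSubsets d (λ X₂ → 𝟙 (disjoint X₁ X₂)) * #missingDiff L d)
    ≡⟨ trans (sumSubsets-*ʳ d _ (#missingDiff L d)) (cong (_* #missingDiff L d) (#disjoint d)) ⟩
  3 ^ d * #missingDiff L d
    ≤⟨ *-monoʳ-≤ (3 ^ d) (#missingDiff-blocks d T R) ⟩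
  3 ^ d * (3 ^ (T * d) * 2 ^ R)
    ≡⟨ *-assoc (3 ^ d) (3 ^ (T * d)) (2 ^ R) ⟨
  3 ^ d * 3 ^ (T * d) * 2 ^ R
    ≡⟨ cong (_* 2 ^ R) (^-distribˡ-+-* 3 d (T * d)) ⟨
  3 ^ (suc T * d) * 2 ^ R ∎
  where
  open ≤-Reasoning
  L = blocks d T R

4^*≤3^*-downward : ∀ c N {q P} → q ≤ P → 4 ^ P * c ≤ 3 ^ P * N → 4 ^ q * c ≤ 3 ^ q * N
4^*≤3^*-downward c N q≤P = go (≤⇒≤′ q≤P)
  where
  step : ∀ P → 4 ^ suc P * c ≤ 3 ^ suc P * N → 4 ^ P * c ≤ 3 ^ P * N
  step P h = *-cancelˡ-≤ 4 (begin
    4 * (4 ^ P * c)      ≡⟨ *-assoc 4 (4 ^ P) c ⟨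
    4 ^ suc P * c        ≤⟨ h ⟩
    3 * 3 ^ P * N        ≡⟨ *-assoc 3 (3 ^ P) N ⟩
    3 * (3 ^ P * N)      ≤⟨ *-monoˡ-≤ (3 ^ P * N) (n≤1+n 3) ⟩
    4 * (3 ^ P * N)      ∎)
    where open ≤-Reasoning
  go : ∀ {P} → _ ≤′ P → 4 ^ P * c ≤ 3 ^ P * N → _
  go ≤′-refl           h = h
  go (≤′-step {P} q≤P) h = go q≤P (step P h)

#missingDiff-short : ∀ n d q → 1 ≤ d → d + d ≤ n → 4 * q ≤ n → 4 ^ q * #missingDiff n d ≤ 3 ^ q * 2 ^ n
#missingDiff-short n d@(suc _) q (s≤s z≤n) 2d≤n 4q≤n = 4^*≤3^*-downward (#missingDiff n d) (2 ^ n) q≤P (begin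
  4 ^ P * #missingDiff n d    ≤⟨ *-monoʳ-≤ (4 ^ P) blockBound ⟩
  4 ^ P * (3 ^ P * 2 ^ R)     ≡⟨ regroup (4 ^ P) (3 ^ P) (2 ^ R) ⟩
  3 ^ P * (2 ^ R * 4 ^ P)     ≡⟨ cong (λ x → 3 ^ P * (2 ^ R * x)) (trans (^-*-assoc 2 2 P) (cong (2 ^_) (double P))) ⟩
  3 ^ P * (2 ^ R * 2 ^ (P + P)) ≡⟨ cong (3 ^ P *_) (^-distribˡ-+-* 2 R (P + P)) ⟨
  3 ^ P * 2 ^ (R + (P + P))   ≡⟨ cong (λ x → 3 ^ P * 2 ^ x) n≡R+2P ⟨
  3 ^ P * 2 ^ n               ∎)
  where
  open ≤-Reasoning
  regroup : ∀ x y z → x * (y * z) ≡ y * (z * x)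
  regroup = ℕSolver.solve-∀
  double : ∀ P → 2 * P ≡ P + P
  double = ℕSolver.solve-∀
  quadruple : ∀ P → 4 * P ≡ (P + P) + (P + P)
  quadruple = ℕSolver.solve-∀
  D = d + d
  T = n / D
  R = n % D
  P = T * d
  n≡R+2P : n ≡ R + (P + P)
  n≡R+2P = trans (m≡m%n+[m/n]*n n D) (trans (cong (_+_ R) (*-comm T D)) (cong (_+_ R) (trans (*-distribʳ-+ T d d) (cong₂ _+_ (*-comm d T) (*-comm d T)))))
  blockBound : #missingDiff n d ≤ 3 ^ P * 2 ^ R
  blockBound = subst (λ k → #missingDiff k d ≤ 3 ^ P * 2 ^ R)
    (trans (blocks≡ d T R) (trans (+-comm (T * D) R) (sym (m≡m%n+[m/n]*n n D)))) (#missingDiff-blocks d T R)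
  d≤P : d ≤ P
  d≤P = subst (_≤ P) (+-identityʳ d) (*-monoˡ-≤ d (m≥n⇒m/n>0 2d≤n))
  q≤P : q ≤ P
  q≤P = *-cancelˡ-≤ 4 (<⇒≤ (≤-<-trans 4q≤n (subst₂ _<_ (sym n≡R+2P) (sym (quadruple P))
          (+-monoˡ-< (P + P) (<-≤-trans (m%n<n n D) (+-mono-≤ d≤P d≤P))))))

#missingDiffSpanning : ℕ → ℕ → ℕ
#missingDiffSpanning N d = sumSubsets N (λ S → 𝟙 (not (hasDiff S d) ∧ (mem S 0 ∧ mem S (N ∸ 1))))

disjoint-with-ends : ∀ {p} → Subset (suc p) → Subset (suc p) → Bool
disjoint-with-ends {p} X Y = mem X 0 ∧ (disjoint X Y ∧ mem Y p)

#disjoint-with-ends : ∀ t → sumSubsets (suc (suc t)) (λ X → sumSubsets (suc (suc t)) (λ Y → 𝟙 (disjoint-with-ends X Y))) ≡ 3 ^ t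
#disjoint-with-ends t = trans (cong₂ _+_
    (trans (sumSubsets-cong (suc t) (λ X → sumSubsets-zero (suc (suc t)))) (sumSubsets-zero (suc t)))
    (sumSubsets-cong (suc t) (λ X → trans (cong (_+_ (sumSubsets (suc t) (λ Y → 𝟙 (disjoint X Y ∧ mem Y t))))
                                                (sumSubsets-zero (suc t)))
                                          (+-identityʳ _))))
  (#disjoint-last t)

-- the difference |X| + |M| joins the i-th points of X and Y
missingDiff⇒disjoint-with-ends : ∀ {p r'} (X : Subset (suc p)) (M : Subset r') (Y : Subset (suc p)) →
  let S = X ++ (M ++ Y) in
  not (hasDiff S (suc p + r')) ∧ (mem S 0 ∧ mem S (suc p + (r' + suc p) ∸ 1)) ≡ true → disjoint-with-ends X Y ≡ true
missingDiff⇒disjoint-with-ends {p} {r'} X M Y h =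
  cong₂ _∧_ (trans (sym (mem-++ˡ X (M ++ Y) 0 (s≤s z≤n))) (∧-conicalˡ _ _ ends))
    (cong₂ _∧_ (disjoint-intro X Y X∩Y≡∅)
      (trans (sym (trans (cong (mem S) (last p r')) (trans (mem-++ʳ X (M ++ Y) (r' + p)) (mem-++ʳ M Y p))))
             (∧-conicalʳ _ _ ends)))
  where
  S = X ++ (M ++ Y)
  d = suc p + r'
  ends = ∧-conicalʳ (not (hasDiff S d)) _ h
  d∉S-S : hasDiff S d ≡ false
  d∉S-S = not-injective (∧-conicalˡ _ _ h)
  reassoc : ∀ i p r' → i + (suc p + r') ≡ suc p + (r' + i)
  reassoc = ℕSolver.solve-∀
  last : ∀ p r' → p + (r' + suc p) ≡ suc p + (r' + p)
  last = ℕSolver.solve-∀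
  X∩Y≡∅ : ∀ i → mem X i ≡ true → mem Y i ≡ true → ⊥
  X∩Y≡∅ i i∈X i∈Y with trans (sym d∉S-S) (hasDiff-intro S i d
    (trans (mem-++ˡ X (M ++ Y) i (mem⇒< X i i∈X)) i∈X)
    (trans (cong (mem S) (reassoc i p r')) (trans (mem-++ʳ X (M ++ Y) (r' + i)) (trans (mem-++ʳ M Y i) i∈Y))))
  ... | ()

#missingDiff-long : ∀ t r' → let p = suc (suc t) in #missingDiffSpanning (p + (r' + p)) (p + r') ≤ 2 ^ r' * 3 ^ t
#missingDiff-long t r' = begin
  #missingDiffSpanning N d
    ≡⟨ sumSubsets-++-++ p r' f ⟩
  sumSubsets p (λ X → sumSubsets r' (λ M → sumSubsets p (λ Y → f (X ++ (M ++ Y)))))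
    ≤⟨ sumSubsets-mono p (λ X → sumSubsets-mono r' (λ M → sumSubsets-mono p (λ Y →
         𝟙-mono _ _ (missingDiff⇒disjoint-with-ends X M Y)))) ⟩
  sumSubsets p (λ X → sumSubsets r' (λ M → sumSubsets p (λ Y → 𝟙 (disjoint-with-ends X Y))))
    ≡⟨ sumSubsets-ignore-middle p r' (λ X Y → 𝟙 (disjoint-with-ends X Y)) ⟩
  2 ^ r' * sumSubsets p (λ X → sumSubsets p (λ Y → 𝟙 (disjoint-with-ends X Y)))
    ≡⟨ cong (2 ^ r' *_) (#disjoint-with-ends t) ⟩
  2 ^ r' * 3 ^ t ∎
  where
  open ≤-Reasoning
  p = suc (suc t)
  N = p + (r' + p)
  d = p + r'
  f : Subset N → ℕ
  f S = 𝟙 (not (hasDiff S d) ∧ (mem S 0 ∧ mem S (N ∸ 1)))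

geometric-sum : ∀ K s (c : ℕ → ℕ) N → (∀ i → i < K → 4 ^ suc (suc (s + i)) * c i ≤ 3 ^ (s + i) * N) →
  4 ^ suc s * sumBelow K c ≤ 3 ^ s * N
geometric-sum zero    s c N _     = ≤-trans (≤-reflexive (*-zeroʳ (4 ^ suc s))) z≤n
geometric-sum (suc K) s c N bound = *-cancelˡ-≤ 4 (begin
  4 * (4 ^ suc s * (c 0 + rest))            ≡⟨ *-assoc 4 (4 ^ suc s) (c 0 + rest) ⟨
  4 ^ suc (suc s) * (c 0 + rest)            ≡⟨ *-distribˡ-+ (4 ^ suc (suc s)) (c 0) rest ⟩
  4 ^ suc (suc s) * c 0 + 4 ^ suc (suc s) * rest
                                            ≤⟨ +-mono-≤ first (geometric-sum K (suc s) (λ i → c (suc i)) N shifted) ⟩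
  3 ^ s * N + 3 * 3 ^ s * N                 ≡⟨ fourfold (3 ^ s) N ⟨
  4 * (3 ^ s * N)                           ∎)
  where
  open ≤-Reasoning
  rest = sumBelow K (λ i → c (suc i))
  first : 4 ^ suc (suc s) * c 0 ≤ 3 ^ s * N
  first = subst (λ j → 4 ^ suc (suc j) * c 0 ≤ 3 ^ j * N) (+-identityʳ s) (bound 0 (s≤s z≤n))
  shifted : ∀ i → i < K → 4 ^ suc (suc (suc s + i)) * c (suc i) ≤ 3 ^ (suc s + i) * N
  shifted i i<K = subst (λ j → 4 ^ suc (suc j) * c (suc i) ≤ 3 ^ j * N) (+-suc s i) (bound (suc i) (s≤s i<K))
  fourfold : ∀ x y → 4 * (x * y) ≡ x * y + 3 * x * y
  fourfold = ℕSolver.solve-∀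

3^q*q²≤7*4^q : ∀ q → 7 ≤ q → 3 ^ q * (q * q) ≤ 7 * 4 ^ q
3^q*q²≤7*4^q q 7≤q = subst (λ q → 3 ^ q * (q * q) ≤ 7 * 4 ^ q) (m+[n∸m]≡n 7≤q) (from7 (q ∸ 7))
  where
  grow : ∀ w → 3 * ((7 + suc w) * (7 + suc w)) + (4 + 8 * w + w * w) ≡ 4 * ((7 + w) * (7 + w))
  grow = ℕSolver.solve-∀
  from7 : ∀ w → 3 ^ (7 + w) * ((7 + w) * (7 + w)) ≤ 7 * 4 ^ (7 + w)
  from7 zero    = ≤ᵇ⇒≤ (3 ^ 7 * 49) (7 * 4 ^ 7) _
  from7 (suc w) = begin
    3 ^ (7 + suc w) * ((7 + suc w) * (7 + suc w))    ≡⟨ *-assoc 3 (3 ^ (7 + w)) ((7 + suc w) * (7 + suc w)) ⟩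
    3 * (3 ^ (7 + w) * ((7 + suc w) * (7 + suc w)))  ≡⟨ x*[y*z]≡y*[x*z] 3 (3 ^ (7 + w)) ((7 + suc w) * (7 + suc w)) ⟩
    3 ^ (7 + w) * (3 * ((7 + suc w) * (7 + suc w)))  ≤⟨ *-monoʳ-≤ (3 ^ (7 + w)) (subst (3 * ((7 + suc w) * (7 + suc w)) ≤_) (grow w) (m≤m+n _ _)) ⟩
    3 ^ (7 + w) * (4 * ((7 + w) * (7 + w)))          ≡⟨ x*[y*z]≡y*[x*z] (3 ^ (7 + w)) 4 ((7 + w) * (7 + w)) ⟩
    4 * (3 ^ (7 + w) * ((7 + w) * (7 + w)))          ≤⟨ *-monoʳ-≤ 4 (from7 w) ⟩
    4 * (7 * 4 ^ (7 + w))                            ≡⟨ x*[y*z]≡y*[x*z] 4 7 (4 ^ (7 + w)) ⟩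
    7 * 4 ^ (7 + suc w)                              ∎
    where open ≤-Reasoning

4*s*3^q*D<4^q : ∀ q D s → 196 * D + 7 ≤ q → s ≤ 4 * q + 3 → 4 * s * 3 ^ q * D < 4 ^ q
4*s*3^q*D<4^q q D s q₀≤q s≤4q+3 = *-cancelʳ-< q (4 * s * 3 ^ q * D) (4 ^ q) (begin-strict
  4 * s * 3 ^ q * D * q            ≤⟨ *-monoˡ-≤ q (*-monoˡ-≤ D (*-monoˡ-≤ (3 ^ q) (*-monoʳ-≤ 4 (≤-trans s≤4q+3 4q+3≤7q)))) ⟩
  4 * (7 * q) * 3 ^ q * D * q      ≡⟨ regroup (3 ^ q) q D ⟩
  28 * D * (3 ^ q * (q * q))       ≤⟨ *-monoʳ-≤ (28 * D) (3^q*q²≤7*4^q q (m+n≤o⇒n≤o (196 * D) q₀≤q)) ⟩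
  28 * D * (7 * 4 ^ q)             ≡⟨ regroup′ D (4 ^ q) ⟩
  196 * D * 4 ^ q                  <⟨ *-monoˡ-< (4 ^ q) ⦃ m^n≢0 4 q ⦄ (m+n≤o⇒m≤o (suc (196 * D)) (subst (_≤ q) (+-suc (196 * D) 6) q₀≤q)) ⟩
  q * 4 ^ q                        ≡⟨ *-comm q (4 ^ q) ⟩
  4 ^ q * q                        ∎)
  where
  open ≤-Reasoning
  4q+3≤7q : 4 * q + 3 ≤ 7 * q
  4q+3≤7q = subst (4 * q + 3 ≤_) (sevenfold q) (+-monoʳ-≤ (4 * q) (*-monoʳ-≤ 3 (≤-trans (s≤s z≤n) (m+n≤o⇒n≤o (196 * D) q₀≤q))))
    where
    sevenfold : ∀ q → 4 * q + 3 * q ≡ 7 * q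
    sevenfold = ℕSolver.solve-∀
  regroup : ∀ x q D → 4 * (7 * q) * x * D * q ≡ 28 * D * (x * (q * q))
  regroup = ℕSolver.solve-∀
  regroup′ : ∀ D y → 28 * D * (7 * y) ≡ 196 * D * y
  regroup′ = ℕSolver.solve-∀

below-positive : ∀ ε → ℚ.0ℚ ℚ.< ε → ∃ λ D → ∀ x c → x * D < suc c → x /1+ c ℚᵘ.< ℚ.toℚᵘ ε
below-positive (mkℚ (+ zero)    _ _) (ℚ.*<* (ℤ.+<+ ()))
below-positive (mkℚ -[1+ _ ]    _ _) (ℚ.*<* ())
below-positive (mkℚ (+ suc p)   d _) _ = suc d , λ x c x*D<1+c → /1+-< (<-≤-trans x*D<1+c (m≤n*m (suc c) (suc p)))

quarter : ∀ n → 4 * (n / 4) ≤ n × n ≤ 4 * (n / 4) + 3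
quarter n = subst (4 * (n / 4) ≤_) (sym n≡) (m≤n+m _ (n % 4))
          , subst (_≤ 4 * (n / 4) + 3) (sym n≡) (subst (n % 4 + 4 * (n / 4) ≤_) (+-comm 3 _) (+-monoˡ-≤ _ (≤-pred (m%n<n n 4))))
  where
  n≡ : n ≡ n % 4 + 4 * (n / 4)
  n≡ = trans (m≡m%n+[m/n]*n n 4) (cong (_+_ (n % 4)) (*-comm (n / 4) 4))

halves : ∀ r → ∃ λ a → ∃ λ b → b ≤ 1 × a + a + b ≡ r
halves r = r / 2 , r % 2 , ≤-pred (m%n<n r 2) ,
  trans (double (r / 2) (r % 2)) (sym (m≡m%n+[m/n]*n r 2))
  where
  double : ∀ a b → a + a + b ≡ b + a * 2
  double = ℕSolver.solve-∀

Estimate : ℕ → ℕ → ℚ → ℕ → Set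
Estimate k m ε n = ℚ.∣ Q n (+ (2 * k)) ℚ.- g (+ k) m ∣ ℚ.< ε ℚ.+ ((+ 16) ℚ./ 9) ℚ.* (((+ 3) ℚ./ 4) ^ᵠ (m + 1))

module Bounds (m₁ a b k : ℕ) (b≤1 : b ≤ 1) where

  open Comparison m₁ (a + a + b) k

  -- the d ≤ short satisfy 2d ≤ n; the other missing d < m + r are the long ones
  short : ℕ
  short = m₁ + a + b

  #missingDiff∧Q-cond : ℕ → ℕ
  #missingDiff∧Q-cond d = sumSubsets n (λ S → 𝟙 (not (hasDiff S d) ∧ Q-cond S))

  #missingSmall≡ : #missingSmall ≡ sumBelow short (λ i → #missingDiff∧Q-cond (suc i)) + sumBelow a (λ i → #missingDiff∧Q-cond (suc (short + i)))
  #missingSmall≡ = begin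
    #missingSmall                                              ≡⟨ sumSubsets-sumBelow n (m₁ + (a + a + b)) (λ S i → 𝟙 (not (hasDiff S (suc i)) ∧ Q-cond S)) ⟩
    sumBelow (m₁ + (a + a + b)) (λ i → #missingDiff∧Q-cond (suc i))
                                                       ≡⟨ cong (λ K → sumBelow K (λ i → #missingDiff∧Q-cond (suc i))) (regroup m₁ a b) ⟩
    sumBelow (short + a) (λ i → #missingDiff∧Q-cond (suc i))   ≡⟨ sumBelow-split short a (λ i → #missingDiff∧Q-cond (suc i)) ⟩
    sumBelow short (λ i → #missingDiff∧Q-cond (suc i)) + sumBelow a (λ i → #missingDiff∧Q-cond (suc (short + i))) ∎
    where
    open ≡-Reasoning
    regroup : ∀ m₁ a b → m₁ + (a + a + b) ≡ m₁ + a + b + a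
    regroup = ℕSolver.solve-∀

  short+short<n : short + short < n
  short+short<n = +-cancelʳ-≤ 1 (suc (short + short)) n (≤-trans (≤-reflexive (excess m₁ a b)) (+-monoʳ-≤ n b≤1))
    where
    excess : ∀ m₁ a b → suc (m₁ + a + b + (m₁ + a + b)) + 1 ≡ suc m₁ + ((a + a + b) + suc m₁) + b
    excess = ℕSolver.solve-∀

  short-bound : ∀ q → 4 * q ≤ n → 4 ^ q * sumBelow short (λ i → #missingDiff∧Q-cond (suc i)) ≤ short * (3 ^ q * 2 ^ n)
  short-bound q 4q≤n = begin
    4 ^ q * sumBelow short (λ i → #missingDiff∧Q-cond (suc i))    ≡⟨ sumBelow-*ˡ short (4 ^ q) (λ i → #missingDiff∧Q-cond (suc i)) ⟩
    sumBelow short (λ i → 4 ^ q * #missingDiff∧Q-cond (suc i))    ≤⟨ sumBelow-mono short (λ i i<short → ≤-trans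
                                                              (*-monoʳ-≤ (4 ^ q) (sumSubsets-mono n (λ S → 𝟙-∧≤ˡ (not (hasDiff S (suc i))) (Q-cond S))))
                                                              (#missingDiff-short n (suc i) q (s≤s z≤n) (2d≤n i<short) 4q≤n)) ⟩
    sumBelow short (λ _ → 3 ^ q * 2 ^ n)                  ≡⟨ sumBelow-const short (3 ^ q * 2 ^ n) ⟩
    short * (3 ^ q * 2 ^ n)                               ∎
    where
    open ≤-Reasoning
    2d≤n : ∀ {i} → i < short → suc i + suc i ≤ n
    2d≤n i<short = ≤-trans (+-mono-≤ i<short i<short) (<⇒≤ short+short<n)

  long-term : ∀ i → i < a → 4 ^ suc (suc (m₁ + i)) * #missingDiff∧Q-cond (suc (short + (a ∸ suc i))) ≤ 3 ^ (m₁ + i) * 2 ^ n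
  long-term i i<a = begin
    4 ^ p * #missingDiff∧Q-cond (suc (short + w))     ≡⟨ cong (4 ^ p *_) (sumSubsets-cong n (λ S →
                                                   cong (λ c → 𝟙 (not (hasDiff S (suc (short + w))) ∧ c))
                                                        (cong₂ _∧_ (∈ᵇ≡mem S 0) (∈ᵇ≡mem S (n ∸ 1))))) ⟩
    4 ^ p * #missingDiffSpanning n (suc (short + w))
                                              ≤⟨ *-monoʳ-≤ (4 ^ p) (subst₂ (λ N d → #missingDiffSpanning N d ≤ 2 ^ r' * 3 ^ t)
                                                   N≡n d≡ (#missingDiff-long t r')) ⟩
    4 ^ p * (2 ^ r' * 3 ^ t)                  ≡⟨ rotate (4 ^ p) (2 ^ r') (3 ^ t) ⟩
    3 ^ t * (2 ^ r' * 4 ^ p)                  ≡⟨ cong (λ x → 3 ^ t * (2 ^ r' * x)) (^-*-assoc 2 2 p) ⟩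
    3 ^ t * (2 ^ r' * 2 ^ (2 * p))            ≡⟨ cong (3 ^ t *_) (^-distribˡ-+-* 2 r' (2 * p)) ⟨
    3 ^ t * 2 ^ (r' + 2 * p)                  ≡⟨ cong (λ x → 3 ^ t * 2 ^ x) (trans (exponent p r') N≡n) ⟩
    3 ^ t * 2 ^ n                             ∎
    where
    open ≤-Reasoning
    w = a ∸ suc i
    t = m₁ + i
    p = suc (suc t)
    r' = w + w + b
    i+w≡a : suc i + w ≡ a
    i+w≡a = m+[n∸m]≡n i<a
    length≡ : ∀ m₁ i w b → suc (suc (m₁ + i)) + ((w + w + b) + suc (suc (m₁ + i))) ≡
                           suc m₁ + ((suc i + w + (suc i + w) + b) + suc m₁)
    length≡ = ℕSolver.solve-∀
    N≡n : p + (r' + p) ≡ n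
    N≡n = trans (length≡ m₁ i w b) (cong (λ x → suc m₁ + ((x + x + b) + suc m₁)) i+w≡a)
    diff≡ : ∀ m₁ i w b → suc (suc (m₁ + i)) + (w + w + b) ≡ suc (m₁ + (suc i + w) + b + w)
    diff≡ = ℕSolver.solve-∀
    d≡ : p + r' ≡ suc (short + w)
    d≡ = trans (diff≡ m₁ i w b) (cong (λ x → suc (m₁ + x + b + w)) i+w≡a)
    rotate : ∀ x y z → x * (y * z) ≡ z * (y * x)
    rotate = ℕSolver.solve-∀
    exponent : ∀ p r' → r' + 2 * p ≡ p + (r' + p)
    exponent = ℕSolver.solve-∀

  long-bound : 4 ^ suc m₁ * sumBelow a (λ i → #missingDiff∧Q-cond (suc (short + i))) ≤ 3 ^ m₁ * 2 ^ n
  long-bound = subst (λ x → 4 ^ suc m₁ * x ≤ 3 ^ m₁ * 2 ^ n) (sym (sumBelow-reverse a (λ i → #missingDiff∧Q-cond (suc (short + i)))))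
    (geometric-sum a m₁ (λ i → #missingDiff∧Q-cond (suc (short + (a ∸ suc i)))) (2 ^ n) long-term)

  #missingSmall-bound : ∀ q → 4 * q ≤ n → #missingSmall * (4 ^ m₁ * 4 ^ q) ≤ (3 ^ m₁ * 4 ^ q + 4 * short * 3 ^ q * 4 ^ m₁) * #Q-cond
  #missingSmall-bound q 4q≤n = begin
    #missingSmall * (4 ^ m₁ * 4 ^ q)                        ≡⟨ cong (_* (4 ^ m₁ * 4 ^ q)) #missingSmall≡ ⟩
    (S + L) * (4 ^ m₁ * 4 ^ q)                      ≡⟨ spread S L (4 ^ m₁) (4 ^ q) ⟩
    4 ^ q * S * 4 ^ m₁ + 4 ^ m₁ * L * 4 ^ q         ≤⟨ +-mono-≤ (*-monoˡ-≤ (4 ^ m₁) short-part) (*-monoˡ-≤ (4 ^ q) long-part) ⟩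
    4 * short * 3 ^ q * C * 4 ^ m₁ + 3 ^ m₁ * C * 4 ^ q
                                                    ≡⟨ collect (4 * short * 3 ^ q) C (4 ^ m₁) (3 ^ m₁) (4 ^ q) ⟩
    (3 ^ m₁ * 4 ^ q + 4 * short * 3 ^ q * 4 ^ m₁) * C ∎
    where
    open ≤-Reasoning
    S = sumBelow short (λ i → #missingDiff∧Q-cond (suc i))
    L = sumBelow a (λ i → #missingDiff∧Q-cond (suc (short + i)))
    C = #Q-cond
    spread : ∀ S L x y → (S + L) * (x * y) ≡ y * S * x + x * L * y
    spread = ℕSolver.solve-∀
    collect : ∀ s C x t y → s * C * x + t * C * y ≡ (t * y + s * x) * C
    collect = ℕSolver.solve-∀
    short-part : 4 ^ q * S ≤ 4 * short * 3 ^ q * C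
    short-part = subst (4 ^ q * S ≤_) (trans (cong (λ z → short * (3 ^ q * z)) (sym 4*#Q-cond≡)) (rearrange short (3 ^ q) C))
                   (short-bound q 4q≤n)
      where
      rearrange : ∀ s x C → s * (x * (4 * C)) ≡ 4 * s * x * C
      rearrange = ℕSolver.solve-∀
    long-part : 4 ^ m₁ * L ≤ 3 ^ m₁ * C
    long-part = *-cancelˡ-≤ 4 (begin
      4 * (4 ^ m₁ * L)      ≡⟨ *-assoc 4 (4 ^ m₁) L ⟨
      4 ^ suc m₁ * L        ≤⟨ long-bound ⟩
      3 ^ m₁ * 2 ^ n        ≡⟨ cong (3 ^ m₁ *_) 4*#Q-cond≡ ⟨
      3 ^ m₁ * (4 * C)      ≡⟨ *-comm (3 ^ m₁) (4 * C) ⟩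
      4 * C * 3 ^ m₁        ≡⟨ *-assoc 4 C (3 ^ m₁) ⟩
      4 * (C * 3 ^ m₁)      ≡⟨ cong (4 *_) (*-comm C (3 ^ m₁)) ⟩
      4 * (3 ^ m₁ * C)      ∎)

  missingSmall/C≤ : ∀ q c → 4 * q ≤ n → #Q-cond ≡ suc c →
    #missingSmall /1+ c ℚᵘ.≤ (3 ^ m₁ /1+ ℕ.pred (4 ^ m₁)) ℚᵘ.+ ((4 * short * 3 ^ q) /1+ ℕ.pred (4 ^ q))
  missingSmall/C≤ q c 4q≤n C≡ = ℚᵘP.≤-respʳ-≃ (ℚᵘP.≃-sym (/1+-+ (3 ^ m₁) p₁ δ p₂)) (/1+-≤ (subst₂
    (λ u v → #missingSmall * (u * v) ≤ (3 ^ m₁ * v + δ * u) * suc c) (sym (suc-pred-4^ m₁)) (sym (suc-pred-4^ q))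
    (subst (λ C → #missingSmall * (4 ^ m₁ * 4 ^ q) ≤ (3 ^ m₁ * 4 ^ q + δ * 4 ^ m₁) * C) C≡ (#missingSmall-bound q 4q≤n))))
    where
    δ = 4 * short * 3 ^ q
    p₁ = ℕ.pred (4 ^ m₁)
    p₂ = ℕ.pred (4 ^ q)

  estimate : ∀ q → 4 * q ≤ n → (ε : ℚ) → (4 * short * 3 ^ q) /1+ ℕ.pred (4 ^ q) ℚᵘ.< ℚ.toℚᵘ ε → Estimate k m ε n
  estimate q 4q≤n ε δ<ε with #Q-cond-nonzero
  ... | c , C≡ = ℚP.toℚᵘ-cancel-< (begin-strict
    ℚ.toℚᵘ (ℚ.∣ Q n (+ (2 * k)) ℚ.- g (+ k) m ∣)        ≃⟨ toℚᵘ-∣-∣-cong (toℚᵘ-Q c C≡) (toℚᵘ-g c C≡) ⟩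
    ℚᵘ.∣ (#Q /1+ c) ℚᵘ.- ((2 ^ r * #g) /1+ c) ∣      ≤⟨ ∣-∣≤-/1+ #Q (2 ^ r * #g) #missingSmall c #Q≤#g+#missingSmall #g≤#Q+#missingSmall ⟩
    #missingSmall /1+ c                             ≤⟨ missingSmall/C≤ q c 4q≤n C≡ ⟩
    ¾^m₁ ℚᵘ.+ ((4 * short * 3 ^ q) /1+ ℕ.pred (4 ^ q)) <⟨ ℚᵘP.+-monoʳ-< ¾^m₁ δ<ε ⟩
    ¾^m₁ ℚᵘ.+ ℚ.toℚᵘ ε                              ≃⟨ ℚᵘP.+-comm ¾^m₁ (ℚ.toℚᵘ ε) ⟩
    ℚ.toℚᵘ ε ℚᵘ.+ ¾^m₁                              ≃⟨ ℚᵘP.+-congʳ (ℚ.toℚᵘ ε) (ℚᵘP.≃-sym (toℚᵘ-16/9*¾^ m₁)) ⟩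
    ℚ.toℚᵘ ε ℚᵘ.+ ℚ.toℚᵘ Z                          ≃⟨ ℚᵘP.≃-sym (ℚP.toℚᵘ-homo-+ ε Z) ⟩
    ℚ.toℚᵘ (ε ℚ.+ Z)                                ∎)
    where
    open ℚᵘP.≤-Reasoning
    r = a + a + b
    Z = ((+ 16) ℚ./ 9) ℚ.* (((+ 3) ℚ./ 4) ^ᵠ (m + 1))
    ¾^m₁ = 3 ^ m₁ /1+ ℕ.pred (4 ^ m₁)

  estimate-for-large-n : ∀ ε D → (∀ x c → x * D < suc c → x /1+ c ℚᵘ.< ℚ.toℚᵘ ε) → 4 * (196 * D + 7) ≤ n →
    Estimate k m ε n
  estimate-for-large-n ε D small⇒<ε 4q₀≤n = estimate q 4q≤n ε (small⇒<ε δ (ℕ.pred (4 ^ q))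
    (subst (δ * D <_) (sym (suc-pred-4^ q)) (4*s*3^q*D<4^q q D short q₀≤q short≤4q+3)))
    where
    q = n / 4
    δ = 4 * short * 3 ^ q
    4q≤n = proj₁ (quarter n)
    q₀≤q : 196 * D + 7 ≤ q
    q₀≤q = ≤-pred (*-cancelˡ-< 4 _ (suc q) (≤-<-trans 4q₀≤n (≤-<-trans (proj₂ (quarter n)) (≤-reflexive (four q)))))
      where
      four : ∀ q → suc (4 * q + 3) ≡ 4 * suc q
      four = ℕSolver.solve-∀
    short≤4q+3 : short ≤ 4 * q + 3
    short≤4q+3 = ≤-trans (m≤m+n short short) (≤-trans (<⇒≤ short+short<n) (proj₂ (quarter n)))

-- The hypothesis k < m only serves to exclude m = 0; the bound holds for every k.
proposition3p11 : (k m : ℕ) → k ℕ.< m → (ε : ℚ) → ℚ.0ℚ ℚ.< ε →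
    ∃ λ N → (n : ℕ) → 2 ℕ.≤ n → N ℕ.≤ n →
      ℚ.∣ Q n (+ (2 ℕ.* k)) ℚ.- g (+ k) m ∣
        ℚ.< ε ℚ.+ ((+ 16) ℚ./ 9) ℚ.* (((+ 3) ℚ./ 4) ^ᵠ (m ℕ.+ 1))
proposition3p11 k zero     () ε 0<ε
proposition3p11 k (suc m₁) _  ε 0<ε = 4 * q₀ + (m + m) , bound
  where
  m = suc m₁
  D = proj₁ (below-positive ε 0<ε)
  q₀ = 196 * D + 7
  bound : (n : ℕ) → 2 ≤ n → 4 * q₀ + (m + m) ≤ n → Estimate k m ε n
  bound n _ N≤n with halves (n ∸ (m + m))
  ... | a , b , b≤1 , a+a+b≡r = subst (Estimate k m ε) length≡n
      (Bounds.estimate-for-large-n m₁ a b k b≤1 ε D (proj₂ (below-positive ε 0<ε))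
        (subst (4 * q₀ ≤_) (sym length≡n) (m+n≤o⇒m≤o (4 * q₀) N≤n)))
    where
    regroup : ∀ m a b → m + ((a + a + b) + m) ≡ (m + m) + (a + a + b)
    regroup = ℕSolver.solve-∀
    length≡n : m + ((a + a + b) + m) ≡ n
    length≡n = trans (regroup m a b) (trans (cong (_+_ (m + m)) a+a+b≡r) (m+[n∸m]≡n (m+n≤o⇒n≤o (4 * q₀) N≤n)))
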